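{- For all integers $m,n\geq 0$: (1) $\displaystyle\mathcal{B}_{m+n}(x)=\sum_{j=0}^m\sum_{k=0}^n x^{m+n-j-k}\,j^{n-k}\binom{n}{k}S(m,j)\,\mathcal{B}_k(x)$; (2) $\displaystyle\mathcal{B}^B_{m+n}(x)=\sum_{j=0}^m\sum_{k=0}^n x^{m+n-j-k}\,(2j+1)^{n-k}\binom{n}{k}S^B(m,j)\,\mathcal{B}_k(2x)$.
   Context: For a set partition $\Lambda$ of a finite set of integers, $(i,j)$ with $i<j$ is an arc if $i,j$ share a block and $j$ is the least element of that block greater than $i$; $\mathrm{Arc}(\Lambda)$ is the set of arcs. $\Pi(n)$ is the set of partitions of $[n]=\{1,\dots,n\}$ ($\Pi(0)=\{\varnothing\}$) and $\mathcal{B}_n(x)=\sum_{\Lambda\in\Pi(n)}x^{|\mathrm{Arc}(\Lambda)|}$; $S(m,j)$ is the number of partitions of $[m]$ into $j$ blocks (so $S(0,j)=\delta_{j,0}$); $0^0=1$. With $[\pm n]=\{\pm1,\dots,\pm n\}$ and $-\Lambda=\{ -B:B\in\Lambda\}$, $\Pi^B(n)$ is the set of partitions $\Lambda$ of $\{0\}\cup[\pm n]$ with $-\Lambda=\Lambda$ in which the only block $B$ with $B=-B$ is the block containing $0$; $\mathcal{B}^B_n(x)=\sum_{\Lambda\in\Pi^B(n)}x^{|\mathrm{Arc}(\Lambda)|/2}$; $S^B(m,j)$ is the number of elements of $\Pi^B(m)$ with $2j+1$ blocks. -}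

module Defs where

open import Data.Bool using (Bool; true; false; _∧_; not; if_then_else_)
open import Data.Nat as ℕ using (ℕ; zero; suc; _+_; _*_; _^_; _∸_; _/_)
open import Data.Nat.Combinatorics using (_C_)
open import Data.Nat.ListAction using (sum)
open import Data.Bool.ListAction using (all; any)
open import Data.Integer as ℤ using (ℤ; +_; -_)
open import Data.List using (List; []; _∷_; [_]; _++_; map; concatMap; filterᵇ;
  length; upTo; cartesianProduct)
open import Data.Product using (_×_; _,_)
open import Relation.Nullary.Decidable using (⌊_⌋)

-- Set partitions of a finite set of integers, given as a list of
-- distinct integers.  A partition is a list of blocks (lists).

insertEach : ℤ → List (List ℤ) → List (List (List ℤ))
insertEach a []       = []
insertEach a (b ∷ bs) = ((a ∷ b) ∷ bs) ∷ map (b ∷_) (insertEach a bs)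

partitions : List ℤ → List (List (List ℤ))
partitions []       = [] ∷ []
partitions (a ∷ xs) =
  concatMap (λ p → ([ a ] ∷ p) ∷ insertEach a p) (partitions xs)

_==_ : ℤ → ℤ → Bool
i == j = ⌊ i ℤ.≟ j ⌋

_<ᵇ_ : ℤ → ℤ → Bool
i <ᵇ j = ⌊ i ℤ.<? j ⌋

_∈ᵇ_ : ℤ → List ℤ → Bool
i ∈ᵇ B = any (i ==_) B

_⊆ᵇ_ : List ℤ → List ℤ → Bool
A ⊆ᵇ B = all (_∈ᵇ B) A

_≈ᵇ_ : List ℤ → List ℤ → Bool
A ≈ᵇ B = (A ⊆ᵇ B) ∧ (B ⊆ᵇ A)

_∈ᴮ_ : List ℤ → List (List ℤ) → Bool
B ∈ᴮ Λ = any (B ≈ᵇ_) Λ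

_≈ᴾ_ : List (List ℤ) → List (List ℤ) → Bool
Λ ≈ᴾ Μ = all (_∈ᴮ Μ) Λ ∧ all (_∈ᴮ Λ) Μ

negBlock : List ℤ → List ℤ
negBlock B = map -_ B

negPart : List (List ℤ) → List (List ℤ)
negPart Λ = map negBlock Λ

isArcIn : List ℤ → ℤ × ℤ → Bool
isArcIn B (i , j) =
  (i <ᵇ j) ∧ not (any (λ k → (i <ᵇ k) ∧ (k <ᵇ j)) B)

arcsBlock : List ℤ → List (ℤ × ℤ)
arcsBlock B = filterᵇ (isArcIn B) (cartesianProduct B B)

Arc : List (List ℤ) → List (ℤ × ℤ)
Arc Λ = concatMap arcsBlock Λ

[_]ₙ : ℕ → List ℤ
[ n ]ₙ = map (λ i → + suc i) (upTo n)

[±_]₀ : ℕ → List ℤ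
[± n ]₀ = ℤ.0ℤ ∷ ([ n ]ₙ ++ map -_ [ n ]ₙ)

Π : ℕ → List (List (List ℤ))
Π n = partitions [ n ]ₙ

-- Π^B(n): partitions Λ of {0} ∪ [±n] with -Λ = Λ, such that the only
-- block B with B = -B is the block containing 0.
isTypeB : List (List ℤ) → Bool
isTypeB Λ = (negPart Λ ≈ᴾ Λ)
  ∧ all (λ B → if B ≈ᵇ negBlock B then (ℤ.0ℤ ∈ᵇ B) else not (ℤ.0ℤ ∈ᵇ B)) Λ

ΠB : ℕ → List (List (List ℤ))
ΠB n = filterᵇ isTypeB (partitions [± n ]₀)

-- Polynomials, evaluated at a natural number x

𝓑 : ℕ → ℕ → ℕ
𝓑 n x = sum (map (λ Λ → x ^ length (Arc Λ)) (Π n))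

𝓑B : ℕ → ℕ → ℕ
𝓑B n x = sum (map (λ Λ → x ^ (length (Arc Λ) / 2)) (ΠB n))

S : ℕ → ℕ → ℕ
S m j = length (filterᵇ (λ Λ → ⌊ length Λ ℕ.≟ j ⌋) (Π m))

SB : ℕ → ℕ → ℕ
SB m j = length (filterᵇ (λ Λ → ⌊ length Λ ℕ.≟ 2 * j + 1 ⌋) (ΠB m))

Σ[0‥_] : ℕ → (ℕ → ℕ) → ℕ
Σ[0‥ n ] f = sum (map f (upTo (suc n)))

module Submission where

-- Adding one new element to a set partition with j blocks either opens a
-- new block or joins one of the existing ones.  Hence every block-count
-- statistic  Σ_{Λ ∈ Π(N)} f(|Λ|)  equals (𝒯ⁿ f)(0) for the "transfer
-- operator"  (𝒯 f)(j) = f(j+1) + c(j)·f(j),  with c(j) = j ways to join.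
-- For type B (2j+1 blocks: the zero block and j pairs ±B) we add the pair
-- ±(N+1) at once: either as two new singletons, or with −(N+1) joining one
-- of the 2j+1 blocks and +(N+1) the negated block; every other way breaks
-- the symmetry.  So here c(j) = 2j+1.
-- Since |Arc Λ| = (size of ground set) − |Λ|, the polynomials 𝓑, 𝓑ᴮ and the
-- numbers S, Sᴮ are all values of iterates of 𝒯 (module Statistics).
--
-- The identities of the theorem are then a purely algebraic fact about 𝒯
-- (module TransferOperator): 𝒯^{m+n} = 𝒯^m ∘ 𝒯^n; expanding 𝒯^m in the
-- basis of point masses produces the coefficients S(m,j); and if
-- c(j + l) = d + c'(l), then 𝒯^n started at j expands binomially in
-- powers of d with the shifted operator 𝒯'^k started at 0.  The file first
-- develops sums and this operator, then the combinatorics of set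
-- partitions (arc count, block-count recursion, the type-B recursion), and
-- finally assembles the theorem.

open import Defs
open import Data.Nat using (ℕ; _+_; _*_; _^_; _∸_)
open import Data.Nat.Combinatorics using (_C_)
open import Data.Product using (_×_; _,_)
open import Relation.Binary.PropositionalEquality using (_≡_)

module RangeSums where

  open import Data.Nat
  open import Data.Nat.Properties
  open import Data.Nat.ListAction using (sum)
  open import Data.List using (map; applyUpTo)
  open import Data.Bool using (if_then_else_)
  open import Data.Nat.Tactic.RingSolver
  open import Relation.Binary.PropositionalEquality
  open import Relation.Nullary using (yes; no; contradiction)
  open import Relation.Nullary.Decidable using (⌊_⌋)
  open import Data.Sum using (inj₁; inj₂)
  open import Function using (_∘_)
  open ≡-Reasoning

  Σ≤ : ℕ → (ℕ → ℕ) → ℕ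
  Σ≤ zero f = f 0
  Σ≤ (suc n) f = Σ≤ n f + f (suc n)

  Σ≤-cong : ∀ n {f g : ℕ → ℕ} → (∀ k → k ≤ n → f k ≡ g k) → Σ≤ n f ≡ Σ≤ n g
  Σ≤-cong zero h = h 0 z≤n
  Σ≤-cong (suc n) h = cong₂ _+_ (Σ≤-cong n (λ k k≤n → h k (m≤n⇒m≤1+n k≤n))) (h (suc n) ≤-refl)

  Σ≤-shift : ∀ n f → Σ≤ (suc n) f ≡ f 0 + Σ≤ n (λ k → f (suc k))
  Σ≤-shift zero f = refl
  Σ≤-shift (suc n) f = begin
    Σ≤ (suc n) f + f (suc (suc n))                    ≡⟨ cong (_+ f (suc (suc n))) (Σ≤-shift n f) ⟩
    (f 0 + Σ≤ n (λ k → f (suc k))) + f (suc (suc n))  ≡⟨ +-assoc (f 0) _ _ ⟩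
    f 0 + (Σ≤ n (λ k → f (suc k)) + f (suc (suc n)))  ∎

  Σ≤-+ : ∀ n f g → Σ≤ n (λ k → f k + g k) ≡ Σ≤ n f + Σ≤ n g
  Σ≤-+ zero f g = refl
  Σ≤-+ (suc n) f g = trans (cong (_+ (f (suc n) + g (suc n))) (Σ≤-+ n f g))
                           (interchange (Σ≤ n f) (Σ≤ n g) (f (suc n)) (g (suc n)))
    where
    interchange : ∀ a b c d → (a + b) + (c + d) ≡ (a + c) + (b + d)
    interchange = solve-∀

  Σ≤-* : ∀ n a f → a * Σ≤ n f ≡ Σ≤ n (λ k → a * f k)
  Σ≤-* zero a f = refl
  Σ≤-* (suc n) a f = trans (*-distribˡ-+ a (Σ≤ n f) (f (suc n))) (cong (_+ a * f (suc n)) (Σ≤-* n a f))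

  Σ≤-0 : ∀ n → Σ≤ n (λ _ → 0) ≡ 0
  Σ≤-0 zero = refl
  Σ≤-0 (suc n) = cong (_+ 0) (Σ≤-0 n)

  Σ[0‥]≡Σ≤ : ∀ n f → Σ[0‥ n ] f ≡ Σ≤ n f
  Σ[0‥]≡Σ≤ n f = applyUpTo-sum n (λ b → b)
    where
    applyUpTo-sum : ∀ n (g : ℕ → ℕ) → sum (map f (applyUpTo g (suc n))) ≡ Σ≤ n (f ∘ g)
    applyUpTo-sum zero g = +-identityʳ (f (g 0))
    applyUpTo-sum (suc n) g = trans (cong (f (g 0) +_) (applyUpTo-sum n (g ∘ suc))) (sym (Σ≤-shift n (f ∘ g)))

  double-sum : ∀ m n (t u : ℕ → ℕ → ℕ) → (∀ j k → t j k ≡ u j k) →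
               Σ≤ m (λ j → Σ≤ n (t j)) ≡ Σ[0‥ m ] (λ j → Σ[0‥ n ] (u j))
  double-sum m n t u t≡u = sym (trans (Σ[0‥]≡Σ≤ m _) (Σ≤-cong m (λ j _ →
    trans (Σ[0‥]≡Σ≤ n _) (Σ≤-cong n (λ k _ → sym (t≡u j k))))))

  δ : ℕ → ℕ → ℕ
  δ j b = if ⌊ b ≟ j ⌋ then 1 else 0

  δ-same : ∀ j → δ j j ≡ 1
  δ-same j with j ≟ j
  ... | yes _ = refl
  ... | no j≢j = contradiction refl j≢j

  δ-other : ∀ {j b} → b ≢ j → δ j b ≡ 0
  δ-other {j} {b} b≢j with b ≟ j
  ... | yes b≡j = contradiction b≡j b≢j
  ... | no _ = refl

  Σ≤-δ : ∀ n (g : ℕ → ℕ) b → b ≤ n → Σ≤ n (λ i → g i * δ i b) ≡ g b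
  Σ≤-δ zero g .0 z≤n = *-identityʳ (g 0)
  Σ≤-δ (suc n) g b b≤1+n with m≤n⇒m<n∨m≡n b≤1+n
  ... | inj₂ refl = begin
    Σ≤ n (λ i → g i * δ i (suc n)) + g (suc n) * δ (suc n) (suc n)
      ≡⟨ cong₂ _+_ (trans (Σ≤-cong n (λ i i≤n → vanish i (λ e → <-irrefl (sym e) (s≤s i≤n)))) (Σ≤-0 n))
                   (trans (cong (g (suc n) *_) (δ-same (suc n))) (*-identityʳ (g (suc n)))) ⟩
    0 + g (suc n) ∎
    where
    vanish : ∀ i → suc n ≢ i → g i * δ i (suc n) ≡ 0
    vanish i ne = trans (cong (g i *_) (δ-other ne)) (*-zeroʳ (g i))
  ... | inj₁ (s≤s b≤n) = begin
    Σ≤ n (λ i → g i * δ i b) + g (suc n) * δ (suc n) b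
      ≡⟨ cong (Σ≤ n (λ i → g i * δ i b) +_) (trans (cong (g (suc n) *_) (δ-other b≢1+n)) (*-zeroʳ (g (suc n)))) ⟩
    Σ≤ n (λ i → g i * δ i b) + 0
      ≡⟨ +-identityʳ _ ⟩
    Σ≤ n (λ i → g i * δ i b)
      ≡⟨ Σ≤-δ n g b b≤n ⟩
    g b ∎
    where
    b≢1+n : b ≢ suc n
    b≢1+n b≡1+n = <-irrefl b≡1+n (s≤s b≤n)

-- The transfer operator  (𝒯 c f)(j) = f(j+1) + c(j)·f(j)  and its iterates.
-- Here f is a weight on block counts and c(j) counts the ways a new
-- element may join a partition with j blocks.
module TransferOperator where

  open RangeSums
  open import Data.Nat
  open import Data.Nat.Properties
  open import Data.Nat.Combinatorics using (_C_; nCk+nC[k+1]≡[n+1]C[k+1]; k>n⇒nCk≡0)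
  open import Data.Nat.Tactic.RingSolver
  open import Relation.Binary.PropositionalEquality
  open ≡-Reasoning

  𝒯 : (ℕ → ℕ) → (ℕ → ℕ) → ℕ → ℕ
  𝒯 c f j = f (suc j) + c j * f j

  𝒯ⁿ : (ℕ → ℕ) → ℕ → (ℕ → ℕ) → ℕ → ℕ
  𝒯ⁿ c zero f = f
  𝒯ⁿ c (suc n) f = 𝒯ⁿ c n (𝒯 c f)

  𝒯ⁿ-local : ∀ c n {f g : ℕ → ℕ} j → (∀ d → d ≤ n → f (j + d) ≡ g (j + d)) → 𝒯ⁿ c n f j ≡ 𝒯ⁿ c n g j
  𝒯ⁿ-local c zero {f} {g} j h = trans (cong f (sym (+-identityʳ j))) (trans (h 0 z≤n) (cong g (+-identityʳ j)))
  𝒯ⁿ-local c (suc n) {f} {g} j h = 𝒯ⁿ-local c n j λ d d≤n →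
    cong₂ _+_ (trans (cong f (sym (+-suc j d))) (trans (h (suc d) (s≤s d≤n)) (cong g (+-suc j d))))
              (cong (c (j + d) *_) (h d (m≤n⇒m≤1+n d≤n)))

  𝒯ⁿ-cong : ∀ c n {f g : ℕ → ℕ} j → (∀ b → f b ≡ g b) → 𝒯ⁿ c n f j ≡ 𝒯ⁿ c n g j
  𝒯ⁿ-cong c n j h = 𝒯ⁿ-local c n j (λ d _ → h (j + d))

  𝒯ⁿ-+ : ∀ c n f g j → 𝒯ⁿ c n (λ b → f b + g b) j ≡ 𝒯ⁿ c n f j + 𝒯ⁿ c n g j
  𝒯ⁿ-+ c zero f g j = refl
  𝒯ⁿ-+ c (suc n) f g j = trans (𝒯ⁿ-cong c n j (λ b → distrib (f (suc b)) (g (suc b)) (c b) (f b) (g b)))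
                               (𝒯ⁿ-+ c n (𝒯 c f) (𝒯 c g) j)
    where
    distrib : ∀ a b x d e → a + b + x * (d + e) ≡ (a + x * d) + (b + x * e)
    distrib = solve-∀

  𝒯ⁿ-* : ∀ c n a f j → 𝒯ⁿ c n (λ b → a * f b) j ≡ a * 𝒯ⁿ c n f j
  𝒯ⁿ-* c zero a f j = refl
  𝒯ⁿ-* c (suc n) a f j = trans (𝒯ⁿ-cong c n j (λ b → distrib a (f (suc b)) (c b) (f b)))
                               (𝒯ⁿ-* c n a (𝒯 c f) j)
    where
    distrib : ∀ a p x q → a * p + x * (a * q) ≡ a * (p + x * q)
    distrib = solve-∀

  𝒯ⁿ-Σ : ∀ c n K (a : ℕ → ℕ) (h : ℕ → ℕ → ℕ) j →
         𝒯ⁿ c n (λ b → Σ≤ K (λ i → a i * h i b)) j ≡ Σ≤ K (λ i → a i * 𝒯ⁿ c n (h i) j)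
  𝒯ⁿ-Σ c n zero a h j = 𝒯ⁿ-* c n (a 0) (h 0) j
  𝒯ⁿ-Σ c n (suc K) a h j = begin
    𝒯ⁿ c n (λ b → Σ≤ K (λ i → a i * h i b) + a (suc K) * h (suc K) b) j
      ≡⟨ 𝒯ⁿ-+ c n _ _ j ⟩
    𝒯ⁿ c n (λ b → Σ≤ K (λ i → a i * h i b)) j + 𝒯ⁿ c n (λ b → a (suc K) * h (suc K) b) j
      ≡⟨ cong₂ _+_ (𝒯ⁿ-Σ c n K a h j) (𝒯ⁿ-* c n (a (suc K)) (h (suc K)) j) ⟩
    Σ≤ K (λ i → a i * 𝒯ⁿ c n (h i) j) + a (suc K) * 𝒯ⁿ c n (h (suc K)) j ∎

  𝒯ⁿ-𝒯 : ∀ c n f j → 𝒯ⁿ c n (𝒯 c f) j ≡ 𝒯 c (𝒯ⁿ c n f) j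
  𝒯ⁿ-𝒯 c zero f j = refl
  𝒯ⁿ-𝒯 c (suc n) f j = 𝒯ⁿ-𝒯 c n (𝒯 c f) j

  𝒯ⁿ-compose : ∀ c m n f j → 𝒯ⁿ c (m + n) f j ≡ 𝒯ⁿ c m (𝒯ⁿ c n f) j
  𝒯ⁿ-compose c zero n f j = refl
  𝒯ⁿ-compose c (suc m) n f j = trans (𝒯ⁿ-compose c m n (𝒯 c f) j)
    (𝒯ⁿ-cong c m j (λ b → 𝒯ⁿ-𝒯 c n f b))

  -- Expansion in point masses: the coefficient of g(j) in (𝒯^m g)(0) is
  -- (𝒯^m δ_j)(0) (a Stirling number in the applications).
  𝒯ⁿ-decompose : ∀ c m g → 𝒯ⁿ c m g 0 ≡ Σ≤ m (λ j → 𝒯ⁿ c m (δ j) 0 * g j)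
  𝒯ⁿ-decompose c m g = begin
    𝒯ⁿ c m g 0                                      ≡⟨ 𝒯ⁿ-local c m 0 (λ d d≤m → sym (Σ≤-δ m g d d≤m)) ⟩
    𝒯ⁿ c m (λ b → Σ≤ m (λ i → g i * δ i b)) 0       ≡⟨ 𝒯ⁿ-Σ c m m g δ 0 ⟩
    Σ≤ m (λ i → g i * 𝒯ⁿ c m (δ i) 0)               ≡⟨ Σ≤-cong m (λ i _ → *-comm (g i) _) ⟩
    Σ≤ m (λ j → 𝒯ⁿ c m (δ j) 0 * g j)               ∎

  -- Pascal's rule lifted to binomial sums:
  -- Σ_k C(n+1,k) d^{n+1-k} e(k) = Σ_k C(n,k) d^{n-k} (e(k+1) + d·e(k)).
  binomial-step : ∀ n d (e : ℕ → ℕ) →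
    Σ≤ (suc n) (λ k → (suc n C k) * d ^ (suc n ∸ k) * e k)
    ≡ Σ≤ n (λ k → (n C k) * d ^ (n ∸ k) * e (suc k)) + d * Σ≤ n (λ k → (n C k) * d ^ (n ∸ k) * e k)
  binomial-step n d e = begin
    Σ≤ (suc n) (λ k → (suc n C k) * d ^ (suc n ∸ k) * e k)
      ≡⟨ Σ≤-shift n _ ⟩
    A + Σ≤ n (λ k → (suc n C suc k) * d ^ (n ∸ k) * e (suc k))
      ≡⟨ cong (A +_) (Σ≤-cong n (λ k _ → pascal k)) ⟩
    A + Σ≤ n (λ k → (n C k) * d ^ (n ∸ k) * e (suc k) + (n C suc k) * d ^ (n ∸ k) * e (suc k))
      ≡⟨ cong (A +_) (Σ≤-+ n _ _) ⟩
    A + (Σ₁ + Σ₂)                   ≡⟨ swap-left A Σ₁ Σ₂ ⟩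
    Σ₁ + (A + Σ₂)                   ≡⟨ cong (Σ₁ +_) (sym (Σ≤-shift n v)) ⟩
    Σ₁ + Σ≤ (suc n) v               ≡⟨ cong (Σ₁ +_) (trans (cong (Σ≤ n v +_) v-top) (+-identityʳ _)) ⟩
    Σ₁ + Σ≤ n v                     ≡⟨ cong (Σ₁ +_) (trans (Σ≤-cong n v≡d*u) (sym (Σ≤-* n d u))) ⟩
    Σ₁ + d * Σ≤ n u ∎
    where
    A = (suc n C 0) * d ^ (suc n) * e 0
    u = λ k → (n C k) * d ^ (n ∸ k) * e k
    v = λ k → (n C k) * d ^ (suc n ∸ k) * e k
    Σ₁ = Σ≤ n (λ k → (n C k) * d ^ (n ∸ k) * e (suc k))
    Σ₂ = Σ≤ n (λ k → (n C suc k) * d ^ (n ∸ k) * e (suc k))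
    swap-left : ∀ a b c → a + (b + c) ≡ b + (a + c)
    swap-left = solve-∀
    pascal : ∀ k → (suc n C suc k) * d ^ (n ∸ k) * e (suc k)
                 ≡ (n C k) * d ^ (n ∸ k) * e (suc k) + (n C suc k) * d ^ (n ∸ k) * e (suc k)
    pascal k = trans (cong (λ z → z * d ^ (n ∸ k) * e (suc k)) (sym (nCk+nC[k+1]≡[n+1]C[k+1] n k)))
                     (distrib (n C k) (n C suc k) (d ^ (n ∸ k)) (e (suc k)))
      where
      distrib : ∀ a b x y → (a + b) * x * y ≡ a * x * y + b * x * y
      distrib = solve-∀
    v-top : v (suc n) ≡ 0
    v-top = cong (λ z → z * d ^ (suc n ∸ suc n) * e (suc n)) (k>n⇒nCk≡0 {n} {suc n} (n<1+n n))
    v≡d*u : ∀ k → k ≤ n → v k ≡ d * u k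
    v≡d*u k k≤n = begin
      (n C k) * d ^ (suc n ∸ k) * e k    ≡⟨ cong (λ z → (n C k) * d ^ z * e k) (+-∸-assoc 1 k≤n) ⟩
      (n C k) * (d * d ^ (n ∸ k)) * e k  ≡⟨ reassoc (n C k) d (d ^ (n ∸ k)) (e k) ⟩
      d * ((n C k) * d ^ (n ∸ k) * e k)  ∎
      where
      reassoc : ∀ a b x y → a * (b * x) * y ≡ b * (a * x * y)
      reassoc = solve-∀

  𝒯ⁿ-shift : ∀ c c' j d → (∀ l → c (j + l) ≡ d + c' l) → ∀ n f →
    𝒯ⁿ c n f j ≡ Σ≤ n (λ k → (n C k) * d ^ (n ∸ k) * 𝒯ⁿ c' k (λ l → f (j + l)) 0)
  𝒯ⁿ-shift c c' j d split zero f = trans (cong f (sym (+-identityʳ j))) (sym (*-identityˡ (f (j + 0))))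
  𝒯ⁿ-shift c c' j d split (suc n) f = begin
    𝒯ⁿ c n (𝒯 c f) j
      ≡⟨ 𝒯ⁿ-shift c c' j d split n (𝒯 c f) ⟩
    Σ≤ n (λ k → (n C k) * d ^ (n ∸ k) * 𝒯ⁿ c' k (λ l → 𝒯 c f (j + l)) 0)
      ≡⟨ Σ≤-cong n (λ k _ → cong ((n C k) * d ^ (n ∸ k) *_) (shifted-step k)) ⟩
    Σ≤ n (λ k → (n C k) * d ^ (n ∸ k) * (e (suc k) + d * e k))
      ≡⟨ Σ≤-cong n (λ k _ → distrib ((n C k) * d ^ (n ∸ k)) (e (suc k)) d (e k)) ⟩
    Σ≤ n (λ k → (n C k) * d ^ (n ∸ k) * e (suc k) + d * ((n C k) * d ^ (n ∸ k) * e k))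
      ≡⟨ Σ≤-+ n _ _ ⟩
    Σ≤ n (λ k → (n C k) * d ^ (n ∸ k) * e (suc k)) + Σ≤ n (λ k → d * ((n C k) * d ^ (n ∸ k) * e k))
      ≡⟨ cong (Σ≤ n (λ k → (n C k) * d ^ (n ∸ k) * e (suc k)) +_) (sym (Σ≤-* n d _)) ⟩
    Σ≤ n (λ k → (n C k) * d ^ (n ∸ k) * e (suc k)) + d * Σ≤ n (λ k → (n C k) * d ^ (n ∸ k) * e k)
      ≡⟨ sym (binomial-step n d e) ⟩
    Σ≤ (suc n) (λ k → (suc n C k) * d ^ (suc n ∸ k) * e k) ∎
    where
    F = λ l → f (j + l)
    e = λ k → 𝒯ⁿ c' k F 0
    distrib : ∀ a x d y → a * (x + d * y) ≡ a * x + d * (a * y)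
    distrib = solve-∀
    pointwise : ∀ l → 𝒯 c f (j + l) ≡ 𝒯 c' F l + d * F l
    pointwise l = begin
      f (suc (j + l)) + c (j + l) * f (j + l)  ≡⟨ cong₂ _+_ (cong f (sym (+-suc j l))) (cong (_* f (j + l)) (split l)) ⟩
      f (j + suc l) + (d + c' l) * f (j + l)   ≡⟨ distrib′ (f (j + suc l)) d (c' l) (f (j + l)) ⟩
      f (j + suc l) + c' l * f (j + l) + d * f (j + l) ∎
      where
      distrib′ : ∀ a d x y → a + (d + x) * y ≡ a + x * y + d * y
      distrib′ = solve-∀
    shifted-step : ∀ k → 𝒯ⁿ c' k (λ l → 𝒯 c f (j + l)) 0 ≡ e (suc k) + d * e k
    shifted-step k = begin
      𝒯ⁿ c' k (λ l → 𝒯 c f (j + l)) 0                   ≡⟨ 𝒯ⁿ-cong c' k 0 pointwise ⟩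
      𝒯ⁿ c' k (λ l → 𝒯 c' F l + d * F l) 0              ≡⟨ 𝒯ⁿ-+ c' k _ _ 0 ⟩
      𝒯ⁿ c' k (𝒯 c' F) 0 + 𝒯ⁿ c' k (λ l → d * F l) 0   ≡⟨ cong (𝒯ⁿ c' k (𝒯 c' F) 0 +_) (𝒯ⁿ-* c' k d F 0) ⟩
      e (suc k) + d * e k ∎

  𝒯ⁿ-scale : ∀ a c k h j → 𝒯ⁿ (λ l → a * c l) k (λ l → a ^ l * h l) j ≡ a ^ (j + k) * 𝒯ⁿ c k h j
  𝒯ⁿ-scale a c zero h j = cong (λ z → a ^ z * h j) (sym (+-identityʳ j))
  𝒯ⁿ-scale a c (suc k) h j = begin
    𝒯ⁿ (λ l → a * c l) k (𝒯 (λ l → a * c l) (λ l → a ^ l * h l)) j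
      ≡⟨ 𝒯ⁿ-cong _ k j (λ l → factor a (a ^ l) (h (suc l)) (c l) (h l)) ⟩
    𝒯ⁿ (λ l → a * c l) k (λ l → a ^ l * (a * 𝒯 c h l)) j
      ≡⟨ 𝒯ⁿ-scale a c k (λ l → a * 𝒯 c h l) j ⟩
    a ^ (j + k) * 𝒯ⁿ c k (λ l → a * 𝒯 c h l) j
      ≡⟨ cong (a ^ (j + k) *_) (𝒯ⁿ-* c k a (𝒯 c h) j) ⟩
    a ^ (j + k) * (a * 𝒯ⁿ c k (𝒯 c h) j)
      ≡⟨ reassoc (a ^ (j + k)) a (𝒯ⁿ c k (𝒯 c h) j) ⟩
    a * a ^ (j + k) * 𝒯ⁿ c k (𝒯 c h) j
      ≡⟨ cong (λ z → a ^ z * 𝒯ⁿ c k (𝒯 c h) j) (sym (+-suc j k)) ⟩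
    a ^ (j + suc k) * 𝒯ⁿ c (suc k) h j ∎
    where
    factor : ∀ a P H1 Cc H0 → a * P * H1 + a * Cc * (P * H0) ≡ P * (a * (H1 + Cc * H0))
    factor = solve-∀
    reassoc : ∀ P a X → P * (a * X) ≡ a * P * X
    reassoc = solve-∀

  exponent-split : ∀ m n j k l → j ≤ m → k ≤ n → l ≤ k → m + n ∸ (j + l) ≡ (m + n ∸ j ∸ k) + (k ∸ l)
  exponent-split m n j k l j≤m k≤n l≤k = begin
    m + n ∸ (j + l)             ≡⟨ sym (∸-+-assoc (m + n) j l) ⟩
    m + n ∸ j ∸ l               ≡⟨ cong (_∸ l) (sym (m∸n+n≡m k≤rest)) ⟩
    (m + n ∸ j ∸ k) + k ∸ l     ≡⟨ +-∸-assoc (m + n ∸ j ∸ k) l≤k ⟩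
    (m + n ∸ j ∸ k) + (k ∸ l)   ∎
    where
    k≤rest : k ≤ m + n ∸ j
    k≤rest = ≤-trans k≤n (≤-trans (m≤n+m n (m ∸ j)) (≤-reflexive (sym (+-∸-comm n j≤m))))

  𝒯ⁿ-powers : ∀ c' x m n j k → j ≤ m → k ≤ n →
    𝒯ⁿ c' k (λ l → x ^ (m + n ∸ (j + l))) 0 ≡ x ^ (m + n ∸ j ∸ k) * 𝒯ⁿ c' k (λ l → x ^ (k ∸ l)) 0
  𝒯ⁿ-powers c' x m n j k j≤m k≤n = trans (𝒯ⁿ-local c' k 0 (λ d d≤k →
      trans (cong (x ^_) (exponent-split m n j k d j≤m k≤n d≤k)) (^-distribˡ-+-* x (m + n ∸ j ∸ k) (k ∸ d))))
    (𝒯ⁿ-* c' k (x ^ (m + n ∸ j ∸ k)) (λ l → x ^ (k ∸ l)) 0)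

  expansion : ∀ c c' (d : ℕ → ℕ) → (∀ j l → c (j + l) ≡ d j + c' l) → ∀ m n x →
    𝒯ⁿ c (m + n) (λ b → x ^ (m + n ∸ b)) 0
    ≡ Σ≤ m (λ j → Σ≤ n (λ k → x ^ (m + n ∸ j ∸ k) * d j ^ (n ∸ k) * (n C k)
                              * 𝒯ⁿ c m (δ j) 0 * 𝒯ⁿ c' k (λ l → x ^ (k ∸ l)) 0))
  expansion c c' d split m n x = begin
    𝒯ⁿ c (m + n) F 0                                 ≡⟨ 𝒯ⁿ-compose c m n F 0 ⟩
    𝒯ⁿ c m (𝒯ⁿ c n F) 0                              ≡⟨ 𝒯ⁿ-decompose c m (𝒯ⁿ c n F) ⟩
    Σ≤ m (λ j → 𝒯ⁿ c m (δ j) 0 * 𝒯ⁿ c n F j)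
      ≡⟨ Σ≤-cong m (λ j _ → cong (𝒯ⁿ c m (δ j) 0 *_) (𝒯ⁿ-shift c c' j (d j) (split j) n F)) ⟩
    Σ≤ m (λ j → 𝒯ⁿ c m (δ j) 0 * Σ≤ n (λ k → (n C k) * d j ^ (n ∸ k) * 𝒯ⁿ c' k (λ l → F (j + l)) 0))
      ≡⟨ Σ≤-cong m (λ j j≤m → trans (Σ≤-* n (𝒯ⁿ c m (δ j) 0) _) (Σ≤-cong n (λ k k≤n → term j k j≤m k≤n))) ⟩
    Σ≤ m (λ j → Σ≤ n (λ k → x ^ (m + n ∸ j ∸ k) * d j ^ (n ∸ k) * (n C k)
                           * 𝒯ⁿ c m (δ j) 0 * 𝒯ⁿ c' k (λ l → x ^ (k ∸ l)) 0)) ∎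
    where
    F = λ b → x ^ (m + n ∸ b)
    term : ∀ j k → j ≤ m → k ≤ n →
      𝒯ⁿ c m (δ j) 0 * ((n C k) * d j ^ (n ∸ k) * 𝒯ⁿ c' k (λ l → F (j + l)) 0)
      ≡ x ^ (m + n ∸ j ∸ k) * d j ^ (n ∸ k) * (n C k) * 𝒯ⁿ c m (δ j) 0 * 𝒯ⁿ c' k (λ l → x ^ (k ∸ l)) 0
    term j k j≤m k≤n =
      trans (cong (λ z → 𝒯ⁿ c m (δ j) 0 * ((n C k) * d j ^ (n ∸ k) * z)) (𝒯ⁿ-powers c' x m n j k j≤m k≤n))
            (reorder (𝒯ⁿ c m (δ j) 0) (n C k) (d j ^ (n ∸ k)) (x ^ (m + n ∸ j ∸ k)) (𝒯ⁿ c' k (λ l → x ^ (k ∸ l)) 0))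
      where
      reorder : ∀ s b p q t → s * (b * p * (q * t)) ≡ q * p * b * s * t
      reorder = solve-∀


module ListFacts where

  open import Data.Nat using (ℕ; suc; _+_; _*_)
  open import Data.Nat.Properties using (+-suc; *-zeroʳ; *-distribˡ-+)
  open import Data.Nat.ListAction using (sum)
  open import Data.Nat.ListAction.Properties using (sum-++)
  open import Data.Bool using (Bool; true; false; _∧_; not; if_then_else_)
  open import Data.Bool.ListAction using (any; all)
  open import Data.List using (List; []; _∷_; _++_; map; concat; concatMap; filterᵇ; length)
  open import Data.List.Properties using (map-++; map-∘; length-++)
  open import Data.List.Membership.Propositional using (_∈_)
  open import Data.List.Membership.Propositional.Properties using (∈-++⁺ʳ; ∈-concat⁺′)
  open import Data.List.Relation.Unary.Any using (Any; here; there)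
  open import Data.List.Relation.Unary.All using (All; []; _∷_)
  open import Data.List.Relation.Unary.AllPairs using ([]; _∷_)
  open import Data.List.Relation.Unary.Unique.Propositional using (Unique)
  open import Data.List.Relation.Unary.Unique.Propositional.Properties using (Unique[x∷xs]⇒x∉xs)
  open import Data.List.Relation.Binary.Permutation.Propositional using (_↭_; ↭⇒↭ₛ)
  import Data.List.Relation.Binary.Permutation.Setoid.Properties as ↭ₛ
  open import Data.Product using (_×_; _,_; proj₁; proj₂)
  open import Data.Empty using (⊥; ⊥-elim)
  open import Relation.Nullary using (¬_; Dec; yes; no)
  open import Relation.Nullary.Decidable using (⌊_⌋)
  open import Relation.Binary.PropositionalEquality
  open import Data.Nat.Tactic.RingSolver

  private variable X Y : Set

  sumOf : (X → ℕ) → List X → ℕ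
  sumOf g xs = sum (map g xs)

  sumOf-++ : ∀ (g : X → ℕ) xs ys → sumOf g (xs ++ ys) ≡ sumOf g xs + sumOf g ys
  sumOf-++ g xs ys = trans (cong sum (map-++ g xs ys)) (sum-++ (map g xs) (map g ys))

  sumOf-map : ∀ (g : Y → ℕ) (k : X → Y) xs → sumOf g (map k xs) ≡ sumOf (λ x → g (k x)) xs
  sumOf-map g k xs = cong sum (sym (map-∘ xs))

  sumOf-concatMap : ∀ (g : Y → ℕ) (h : X → List Y) xs → sumOf g (concatMap h xs) ≡ sumOf (λ x → sumOf g (h x)) xs
  sumOf-concatMap g h [] = refl
  sumOf-concatMap g h (x ∷ xs) = trans (sumOf-++ g (h x) (concatMap h xs)) (cong (sumOf g (h x) +_) (sumOf-concatMap g h xs))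

  sumOf-cong : ∀ {g h : X → ℕ} xs → (∀ x → x ∈ xs → g x ≡ h x) → sumOf g xs ≡ sumOf h xs
  sumOf-cong [] e = refl
  sumOf-cong (x ∷ xs) e = cong₂ _+_ (e x (here refl)) (sumOf-cong xs (λ y y∈ → e y (there y∈)))

  sumOf-cong′ : ∀ {g h : X → ℕ} xs → (∀ x → g x ≡ h x) → sumOf g xs ≡ sumOf h xs
  sumOf-cong′ xs e = sumOf-cong xs (λ x _ → e x)

  sumOf-+ : ∀ (g h : X → ℕ) xs → sumOf (λ x → g x + h x) xs ≡ sumOf g xs + sumOf h xs
  sumOf-+ g h [] = refl
  sumOf-+ g h (x ∷ xs) = trans (cong (g x + h x +_) (sumOf-+ g h xs)) (interchange (g x) (h x) _ _)
    where
    interchange : ∀ a b c d → a + b + (c + d) ≡ a + c + (b + d)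
    interchange = solve-∀

  sumOf-* : ∀ a (g : X → ℕ) xs → sumOf (λ x → a * g x) xs ≡ a * sumOf g xs
  sumOf-* a g [] = sym (*-zeroʳ a)
  sumOf-* a g (x ∷ xs) = trans (cong (a * g x +_) (sumOf-* a g xs)) (sym (*-distribˡ-+ a (g x) _))

  sumOf-0 : ∀ (xs : List X) → sumOf (λ _ → 0) xs ≡ 0
  sumOf-0 [] = refl
  sumOf-0 (x ∷ xs) = sumOf-0 xs

  sumOf-const : ∀ a (xs : List X) → sumOf (λ _ → a) xs ≡ length xs * a
  sumOf-const a [] = refl
  sumOf-const a (x ∷ xs) = cong (a +_) (sumOf-const a xs)

  ind : Bool → ℕ
  ind b = if b then 1 else 0

  length-filterᵇ : ∀ (p : X → Bool) xs → length (filterᵇ p xs) ≡ sumOf (λ x → ind (p x)) xs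
  length-filterᵇ p [] = refl
  length-filterᵇ p (x ∷ xs) with p x
  ... | true = cong suc (length-filterᵇ p xs)
  ... | false = length-filterᵇ p xs

  ind-not : ∀ (p : X → Bool) xs → sumOf (λ x → ind (p x)) xs + sumOf (λ x → ind (not (p x))) xs ≡ length xs
  ind-not p [] = refl
  ind-not p (x ∷ xs) with p x
  ... | true = cong suc (ind-not p xs)
  ... | false = trans (+-suc _ _) (cong suc (ind-not p xs))

  sumOf-filterᵇ : ∀ (g : X → ℕ) (p : X → Bool) xs → sumOf g (filterᵇ p xs) ≡ sumOf (λ x → if p x then g x else 0) xs
  sumOf-filterᵇ g p [] = refl
  sumOf-filterᵇ g p (x ∷ xs) with p x
  ... | true = cong (g x +_) (sumOf-filterᵇ g p xs)
  ... | false = sumOf-filterᵇ g p xs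

  length-concat : ∀ (xss : List (List X)) → length (concat xss) ≡ sumOf length xss
  length-concat [] = refl
  length-concat (xs ∷ xss) = trans (length-++ xs) (cong (length xs +_) (length-concat xss))

  ⌊⌋-true : ∀ {P : Set} (d : Dec P) → P → ⌊ d ⌋ ≡ true
  ⌊⌋-true (yes _) _ = refl
  ⌊⌋-true (no ¬p) p = ⊥-elim (¬p p)

  ⌊⌋-false : ∀ {P : Set} (d : Dec P) → ¬ P → ⌊ d ⌋ ≡ false
  ⌊⌋-false (yes p) ¬p = ⊥-elim (¬p p)
  ⌊⌋-false (no _) _ = refl

  ⌊⌋-sound : ∀ {P : Set} (d : Dec P) → ⌊ d ⌋ ≡ true → P
  ⌊⌋-sound (yes p) _ = p

  ∧-true : ∀ {a b} → a ∧ b ≡ true → a ≡ true × b ≡ true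
  ∧-true {true} {true} _ = refl , refl

  ∧-intro : ∀ {a b} → a ≡ true → b ≡ true → a ∧ b ≡ true
  ∧-intro refl refl = refl

  false≢true : false ≢ true
  false≢true ()

  bool-iff : ∀ {a b} → (a ≡ true → b ≡ true) → (b ≡ true → a ≡ true) → a ≡ b
  bool-iff {true} {true} f g = refl
  bool-iff {true} {false} f g = sym (f refl)
  bool-iff {false} {true} f g = g refl
  bool-iff {false} {false} f g = refl

  not-true→false : ∀ {a} → ¬ (a ≡ true) → a ≡ false
  not-true→false {true} n = ⊥-elim (n refl)
  not-true→false {false} n = refl

  any-true : ∀ (p : X → Bool) xs → any p xs ≡ true → Any (λ x → p x ≡ true) xs
  any-true p (x ∷ xs) e with p x in eq
  ... | true = here eq
  ... | false = there (any-true p xs e)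

  any-intro : ∀ (p : X → Bool) {x} xs → x ∈ xs → p x ≡ true → any p xs ≡ true
  any-intro p (y ∷ xs) (here refl) e rewrite e = refl
  any-intro p (y ∷ xs) (there x∈) e with p y
  ... | true = refl
  ... | false = any-intro p xs x∈ e

  any-false : ∀ (p : X → Bool) xs → (∀ x → x ∈ xs → p x ≡ false) → any p xs ≡ false
  any-false p [] h = refl
  any-false p (x ∷ xs) h rewrite h x (here refl) = any-false p xs (λ y y∈ → h y (there y∈))

  any-false⁻ : ∀ (p : X → Bool) xs → any p xs ≡ false → ∀ x → x ∈ xs → p x ≡ false
  any-false⁻ p (y ∷ xs) e x x∈ with p y in eq
  any-false⁻ p (y ∷ xs) () x x∈ | true
  any-false⁻ p (y ∷ xs) e x (here refl) | false = eq
  any-false⁻ p (y ∷ xs) e x (there x∈) | false = any-false⁻ p xs e x x∈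

  all-true : ∀ (p : X → Bool) xs → all p xs ≡ true → ∀ x → x ∈ xs → p x ≡ true
  all-true p (y ∷ xs) e x (here refl) = proj₁ (∧-true e)
  all-true p (y ∷ xs) e x (there x∈) = all-true p xs (proj₂ (∧-true {p y} e)) x x∈

  all-intro : ∀ (p : X → Bool) xs → (∀ x → x ∈ xs → p x ≡ true) → all p xs ≡ true
  all-intro p [] h = refl
  all-intro p (x ∷ xs) h = ∧-intro (h x (here refl)) (all-intro p xs (λ y y∈ → h y (there y∈)))

  Unique-resp-↭ : ∀ {xs ys : List X} → xs ↭ ys → Unique xs → Unique ys
  Unique-resp-↭ p = ↭ₛ.Unique-resp-↭ (setoid _) (↭⇒↭ₛ p)

  Unique-++ˡ : ∀ (xs : List X) {ys} → Unique (xs ++ ys) → Unique xs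
  Unique-++ˡ [] u = []
  Unique-++ˡ (x ∷ xs) (a ∷ u) = prefix xs a ∷ Unique-++ˡ xs u
    where
    prefix : ∀ {x : X} xs {ys} → All (λ y → x ≢ y) (xs ++ ys) → All (λ y → x ≢ y) xs
    prefix [] a = []
    prefix (z ∷ zs) (n ∷ a) = n ∷ prefix zs a

  Unique-++ʳ : ∀ (xs : List X) {ys} → Unique (xs ++ ys) → Unique ys
  Unique-++ʳ [] u = u
  Unique-++ʳ (x ∷ xs) (a ∷ u) = Unique-++ʳ xs u

  Unique-disj : ∀ (xs : List X) {ys} → Unique (xs ++ ys) → ∀ {x} → x ∈ xs → x ∈ ys → ⊥
  Unique-disj (z ∷ zs) u (here refl) x∈ys = Unique[x∷xs]⇒x∉xs u (∈-++⁺ʳ zs x∈ys)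
  Unique-disj (z ∷ zs) (_ ∷ u) (there x∈) x∈ys = Unique-disj zs u x∈ x∈ys

  Unique-block : ∀ (Λ : List (List X)) {B} → Unique (concat Λ) → B ∈ Λ → Unique B
  Unique-block (D ∷ Λ) u (here refl) = Unique-++ˡ D u
  Unique-block (D ∷ Λ) u (there B∈) = Unique-block Λ (Unique-++ʳ D u) B∈

  block-unique : ∀ (Λ : List (List X)) {B B′ x} → Unique (concat Λ) → B ∈ Λ → B′ ∈ Λ → x ∈ B → x ∈ B′ → B ≡ B′
  block-unique (D ∷ Λ) u (here refl) (here refl) xB xB′ = refl
  block-unique (D ∷ Λ) u (here refl) (there B′∈) xB xB′ = ⊥-elim (Unique-disj D u xB (∈-concat⁺′ xB′ B′∈))
  block-unique (D ∷ Λ) u (there B∈) (here refl) xB xB′ = ⊥-elim (Unique-disj D u xB′ (∈-concat⁺′ xB B∈))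
  block-unique (D ∷ Λ) u (there B∈) (there B′∈) xB xB′ = block-unique Λ (Unique-++ʳ D u) B∈ B′∈ xB xB′


module SetPartitions where

  open ListFacts
  open TransferOperator using (𝒯; 𝒯ⁿ)
  open import Data.Nat using (ℕ; suc; _+_; _*_)
  open import Data.Nat.Properties using (+-identityʳ)
  open import Data.Integer using (ℤ)
  open import Data.List using (List; []; _∷_; [_]; map; concat; concatMap; length; upTo)
  open import Data.List.Properties using (length-map; length-upTo)
  open import Data.List.Membership.Propositional using (_∈_)
  open import Data.List.Membership.Propositional.Properties using (∈-map⁻; ∈-concat⁻′)
  open import Data.List.Relation.Unary.Any using (here; there)
  open import Data.List.Relation.Unary.All using (All; []; _∷_)
  open import Data.List.Relation.Binary.Permutation.Propositional using (_↭_; ↭-refl; ↭-trans; ↭-prep)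
  open import Data.List.Relation.Binary.Permutation.Propositional.Properties using (shift; ++⁺ˡ)
  open import Data.Product using (∃; _×_; _,_)
  open import Data.Sum using (_⊎_; inj₁; inj₂)
  open import Relation.Binary.PropositionalEquality hiding ([_])
  open ≡-Reasoning

  Part : Set
  Part = List (List ℤ)

  child : ℤ → Part → List Part
  child a p = ([ a ] ∷ p) ∷ insertEach a p

  data Ins (a : ℤ) : Part → Part → Set where
    ins-here : ∀ {B M} → Ins a (B ∷ M) ((a ∷ B) ∷ M)
    ins-there : ∀ {B M X} → Ins a M X → Ins a (B ∷ M) (B ∷ X)

  ∈→Ins : ∀ a M {X} → X ∈ insertEach a M → Ins a M X
  ∈→Ins a (B ∷ M) (here refl) = ins-here
  ∈→Ins a (B ∷ M) (there p) with ∈-map⁻ (B ∷_) p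
  ... | Y , Y∈ , refl = ins-there (∈→Ins a M Y∈)

  Ins-length : ∀ {a M X} → Ins a M X → length X ≡ length M
  Ins-length ins-here = refl
  Ins-length (ins-there i) = cong suc (Ins-length i)

  Ins-concat : ∀ {a M X} → Ins a M X → concat X ↭ a ∷ concat M
  Ins-concat ins-here = ↭-refl
  Ins-concat {a} {B ∷ M} (ins-there i) = ↭-trans (++⁺ˡ B (Ins-concat i)) (shift a B (concat M))

  NonEmpty : List ℤ → Set
  NonEmpty B = ∃ λ x → x ∈ B

  Ins-nonEmpty : ∀ {a M X} → Ins a M X → All NonEmpty M → All NonEmpty X
  Ins-nonEmpty ins-here (_ ∷ nes) = (_ , here refl) ∷ nes
  Ins-nonEmpty (ins-there i) (ne ∷ nes) = ne ∷ Ins-nonEmpty i nes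

  Ins-down : ∀ {a M X C} → Ins a M X → C ∈ X → (C ∈ M) ⊎ (∃ λ B → B ∈ M × C ≡ a ∷ B)
  Ins-down ins-here (here refl) = inj₂ (_ , here refl , refl)
  Ins-down ins-here (there C∈) = inj₁ (there C∈)
  Ins-down (ins-there i) (here refl) = inj₁ (here refl)
  Ins-down (ins-there i) (there C∈) with Ins-down i C∈
  ... | inj₁ c = inj₁ (there c)
  ... | inj₂ (B , B∈ , e) = inj₂ (B , there B∈ , e)

  Ins-up : ∀ {a M X B} → Ins a M X → B ∈ M → (B ∈ X) ⊎ ((a ∷ B) ∈ X)
  Ins-up ins-here (here refl) = inj₂ (here refl)
  Ins-up ins-here (there B∈) = inj₁ (there B∈)
  Ins-up (ins-there i) (here refl) = inj₁ (here refl)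
  Ins-up (ins-there i) (there B∈) with Ins-up i B∈
  ... | inj₁ c = inj₁ (there c)
  ... | inj₂ c = inj₂ (there c)

  Ins-block : ∀ {a M X} → Ins a M X → ∃ λ B → B ∈ M × (a ∷ B) ∈ X
  Ins-block ins-here = _ , here refl , here refl
  Ins-block (ins-there i) with Ins-block i
  ... | B , B∈ , c = B , there B∈ , there c

  length-insertEach : ∀ a (Λ : Part) → length (insertEach a Λ) ≡ length Λ
  length-insertEach a [] = refl
  length-insertEach a (B ∷ Λ) = cong suc (trans (length-map (B ∷_) (insertEach a Λ)) (length-insertEach a Λ))

  -- each of the |Λ| insertions keeps the block count
  sumOf-insertEach : ∀ a (Λ : Part) (g : ℕ → ℕ) → sumOf (λ M → g (length M)) (insertEach a Λ) ≡ length Λ * g (length Λ)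
  sumOf-insertEach a [] g = refl
  sumOf-insertEach a (B ∷ Λ) g = cong (g (suc (length Λ)) +_)
    (trans (sumOf-map (λ M → g (length M)) (B ∷_) (insertEach a Λ)) (sumOf-insertEach a Λ (λ b → g (suc b))))

  -- In type A a new element can join any of the j blocks.
  joinA : ℕ → ℕ
  joinA j = j

  sum-over-blockCount : ∀ l (f : ℕ → ℕ) → sumOf (λ Λ → f (length Λ)) (partitions l) ≡ 𝒯ⁿ joinA (length l) f 0
  sum-over-blockCount [] f = +-identityʳ (f 0)
  sum-over-blockCount (a ∷ xs) f = begin
    sumOf (λ Λ → f (length Λ)) (concatMap (child a) (partitions xs))
      ≡⟨ sumOf-concatMap _ (child a) (partitions xs) ⟩
    sumOf (λ Λ → f (suc (length Λ)) + sumOf (λ M → f (length M)) (insertEach a Λ)) (partitions xs)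
      ≡⟨ sumOf-cong′ (partitions xs) (λ Λ → cong (f (suc (length Λ)) +_) (sumOf-insertEach a Λ f)) ⟩
    sumOf (λ Λ → 𝒯 joinA f (length Λ)) (partitions xs)
      ≡⟨ sum-over-blockCount xs (𝒯 joinA f) ⟩
    𝒯ⁿ joinA (length xs) (𝒯 joinA f) 0 ∎

  PartitionOf : List ℤ → Part → Set
  PartitionOf l Λ = All NonEmpty Λ × concat Λ ↭ l

  partitions-sound : ∀ l {Λ} → Λ ∈ partitions l → PartitionOf l Λ
  partitions-sound [] (here refl) = [] , ↭-refl
  partitions-sound (a ∷ xs) Λ∈ with ∈-concat⁻′ (map (child a) (partitions xs)) Λ∈
  ... | L , Λ∈L , L∈ with ∈-map⁻ (child a) L∈
  ... | Λ₀ , Λ₀∈ , refl with partitions-sound xs Λ₀∈ | Λ∈L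
  ... | nes , pr | here refl = (a , here refl) ∷ nes , ↭-prep a pr
  ... | nes , pr | there X∈ = Ins-nonEmpty i nes , ↭-trans (Ins-concat i) (↭-prep a pr)
    where i = ∈→Ins a Λ₀ X∈

  length-[]ₙ : ∀ n → length [ n ]ₙ ≡ n
  length-[]ₙ n = trans (length-map _ (upTo n)) (length-upTo n)


-- |Arc Λ| = |l| − |Λ| for a partition Λ of a duplicate-free list l: in a
-- block B every element except max B has exactly one arc leaving it.
module ArcCount where

  open ListFacts
  open SetPartitions
  open import Data.Nat using (suc; _+_; _∸_)
  open import Data.Nat.Properties using (m+n∸m≡n; m+n∸n≡m)
  open import Data.Integer as ℤ using (ℤ)
  import Data.Integer.Properties as ℤ
  open import Data.Bool using (Bool; true; false; _∧_; not)
  open import Data.Bool.ListAction using (any)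
  open import Data.List using (List; []; _∷_; map; concat; filterᵇ; length; cartesianProduct)
  open import Data.List.Membership.Propositional using (_∈_; lose)
  open import Data.List.Relation.Unary.Any as Any using (Any; here; there; any?)
  open import Data.List.Relation.Unary.All as All using (All; []; _∷_)
  open import Data.List.Relation.Unary.All.Properties using (All¬⇒¬Any)
  open import Data.List.Relation.Unary.AllPairs using (_∷_)
  open import Data.List.Relation.Unary.Unique.Propositional using (Unique)
  open import Data.List.Relation.Binary.Permutation.Propositional using (↭-sym)
  open import Data.List.Relation.Binary.Permutation.Propositional.Properties using (↭-length)
  open import Data.Product using (∃; _×_; _,_)
  open import Data.Sum using (_⊎_; inj₁; inj₂)
  open import Data.Empty using (⊥-elim)
  open import Relation.Nullary using (yes; no)
  open import Relation.Unary using (Decidable)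
  open import Relation.Binary.PropositionalEquality hiding ([_])
  open import Data.Unit using (⊤; tt)
  open import Data.Nat.Tactic.RingSolver

  total⇒refl : {A : Set} {R : A → A → Set} → (∀ a b → R a b ⊎ R b a) → ∀ a → R a a
  total⇒refl total a with total a a
  ... | inj₁ r = r
  ... | inj₂ r = r

  extremum : {A : Set} {P : A → Set} (P? : Decidable P) (R : A → A → Set)
             (total : ∀ a b → R a b ⊎ R b a) (R-trans : ∀ {a b c} → R a b → R b c → R a c) →
             ∀ xs → Any P xs → ∃ λ m → m ∈ xs × P m × (∀ k → k ∈ xs → P k → R m k)
  extremum {P = P} P? R total R-trans (x ∷ xs) any-P with P? x | any? P? xs | any-P
  ... | no ¬px | _ | here px = ⊥-elim (¬px px)
  ... | no ¬px | _ | there any-P′ with extremum P? R total R-trans xs any-P′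
  ...   | m , m∈ , pm , least = m , there m∈ , pm , λ { k (here refl) pk → ⊥-elim (¬px pk) ; k (there k∈) pk → least k k∈ pk }
  extremum P? R total R-trans (x ∷ xs) _ | yes px | no ¬any | _ =
    x , here refl , px , λ { k (here refl) _ → total⇒refl total x ; k (there k∈) pk → ⊥-elim (¬any (lose k∈ pk)) }
  extremum P? R total R-trans (x ∷ xs) _ | yes px | yes any-P′ | _ with extremum P? R total R-trans xs any-P′
  ... | m , m∈ , pm , least with total x m
  ...   | inj₁ x≤m = x , here refl , px , λ { k (here refl) _ → total⇒refl total x ; k (there k∈) pk → R-trans x≤m (least k k∈ pk) }
  ...   | inj₂ m≤x = m , there m∈ , pm , λ { k (here refl) _ → m≤x ; k (there k∈) pk → least k k∈ pk }

  count-once : ∀ B m → Unique B → m ∈ B → sumOf (λ j → ind (j == m)) B ≡ 1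
  count-once (x ∷ xs) .x (x∉xs ∷ u) (here refl) = cong₂ _+_ (cong ind (⌊⌋-true (x ℤ.≟ x) refl))
    (trans (sumOf-cong xs (λ j j∈ → cong ind (⌊⌋-false (j ℤ.≟ x) (λ { refl → All¬⇒¬Any x∉xs j∈ })))) (sumOf-0 xs))
  count-once (x ∷ xs) m (x∉xs ∷ u) (there m∈) =
    trans (cong (_+ _) (cong ind (⌊⌋-false (x ℤ.≟ m) (λ { refl → All¬⇒¬Any x∉xs m∈ })))) (count-once xs m u m∈)

  count-pairs : ∀ (p : ℤ × ℤ → Bool) B → length (filterᵇ p (cartesianProduct B B))
                ≡ sumOf (λ i → sumOf (λ j → ind (p (i , j))) B) B
  count-pairs p B = trans (length-filterᵇ p (cartesianProduct B B)) (rows B)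
    where
    rows : ∀ A → sumOf (λ ij → ind (p ij)) (cartesianProduct A B) ≡ sumOf (λ i → sumOf (λ j → ind (p (i , j))) B) A
    rows [] = refl
    rows (x ∷ xs) = trans (sumOf-++ (λ ij → ind (p ij)) (map (x ,_) B) (cartesianProduct xs B))
                          (cong₂ _+_ (sumOf-map (λ ij → ind (p ij)) (x ,_) B) (rows xs))

  -- An element i of B has one outgoing arc (to the least element above
  -- it) if something in B lies above i, and none otherwise.
  arcs-from : ∀ B i → Unique B → sumOf (λ j → ind (isArcIn B (i , j))) B ≡ ind (any (i <ᵇ_) B)
  arcs-from B i u with any (i <ᵇ_) B in above
  ... | false = trans (sumOf-cong B (λ j j∈ → cong (λ z → ind (z ∧ not (any (λ k → (i <ᵇ k) ∧ (k <ᵇ j)) B))) (any-false⁻ (i <ᵇ_) B above j j∈))) (sumOf-0 B)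
  ... | true with extremum (i ℤ.<?_) ℤ._≤_ ℤ.≤-total ℤ.≤-trans B (Any.map (⌊⌋-sound (i ℤ.<? _)) (any-true (i <ᵇ_) B above))
  ... | m , m∈ , i<m , least = trans (sumOf-cong B (λ j j∈ → cong ind (arc⇔next j j∈))) (count-once B m u m∈)
    where
    nothing-between : any (λ k → (i <ᵇ k) ∧ (k <ᵇ m)) B ≡ false
    nothing-between = any-false _ B λ k k∈ → between k k∈
      where
      between : ∀ k → k ∈ B → ((i <ᵇ k) ∧ (k <ᵇ m)) ≡ false
      between k k∈ with i ℤ.<? k
      ... | no _ = refl
      ... | yes i<k = ⌊⌋-false (k ℤ.<? m) (ℤ.≤⇒≯ (least k k∈ i<k))
    arc⇔next : ∀ j → j ∈ B → isArcIn B (i , j) ≡ (j == m)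
    arc⇔next j j∈ with j ℤ.≟ m
    ... | yes refl rewrite ⌊⌋-true (i ℤ.<? j) i<m | nothing-between = refl
    ... | no j≢m with i ℤ.<? j
    ...   | no _ = refl
    ...   | yes i<j rewrite any-intro (λ k → (i <ᵇ k) ∧ (k <ᵇ j)) B m∈
                              (∧-intro (⌊⌋-true (i ℤ.<? m) i<m)
                                       (⌊⌋-true (m ℤ.<? j) (ℤ.≤∧≢⇒< (least j j∈ i<j) (λ e → j≢m (sym e))))) = refl

  -- all elements but the maximum have something above them
  elements-with-successor : ∀ B → Unique B → NonEmpty B → sumOf (λ i → ind (any (i <ᵇ_) B)) B ≡ length B ∸ 1
  elements-with-successor B u (x , x∈)
    with extremum {P = λ _ → ⊤} (λ _ → yes tt) (λ a b → b ℤ.≤ a) (λ a b → ℤ.≤-total b a) (λ p q → ℤ.≤-trans q p) B (lose x∈ tt)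
  ... | M , M∈ , _ , maximal = counted
    where
    above⇔not-max : ∀ i → i ∈ B → any (i <ᵇ_) B ≡ not (i == M)
    above⇔not-max i i∈ with i ℤ.≟ M
    ... | yes refl = any-false _ B (λ k k∈ → ⌊⌋-false (i ℤ.<? k) (ℤ.≤⇒≯ (maximal k k∈ tt)))
    ... | no i≢M = any-intro (i <ᵇ_) B M∈ (⌊⌋-true (i ℤ.<? M) (ℤ.≤∧≢⇒< (maximal i i∈ tt) i≢M))
    rest = sumOf (λ i → ind (not (i == M))) B
    total : 1 + rest ≡ length B
    total = trans (cong (_+ rest) (sym (count-once B M u M∈))) (ind-not (_== M) B)
    counted : sumOf (λ i → ind (any (i <ᵇ_) B)) B ≡ length B ∸ 1
    counted = trans (sumOf-cong B (λ i i∈ → cong ind (above⇔not-max i i∈)))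
                   (trans (sym (m+n∸m≡n 1 rest)) (cong (_∸ 1) total))

  arcs-of-block : ∀ B → Unique B → NonEmpty B → length (arcsBlock B) ≡ length B ∸ 1
  arcs-of-block B u ne = trans (count-pairs (isArcIn B) B)
                               (trans (sumOf-cong B (λ i _ → arcs-from B i u)) (elements-with-successor B u ne))

  sumOf-pred : ∀ (Λ : Part) → All NonEmpty Λ → sumOf (λ B → length B ∸ 1) Λ + length Λ ≡ sumOf length Λ
  sumOf-pred [] [] = refl
  sumOf-pred ((x ∷ B) ∷ Λ) (_ ∷ nes) =
    trans (rearrange (length B) (sumOf (λ B → length B ∸ 1) Λ) (length Λ)) (cong (suc (length B) +_) (sumOf-pred Λ nes))
    where
    rearrange : ∀ a b c → a + b + suc c ≡ suc a + (b + c)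
    rearrange = solve-∀
  sumOf-pred ([] ∷ Λ) ((_ , ()) ∷ _)

  arc-count : ∀ l (Λ : Part) → Unique l → PartitionOf l Λ → length (Arc Λ) ≡ length l ∸ length Λ
  arc-count l Λ u (nes , pr) =
    trans (length-concat (map arcsBlock Λ)) (trans (sumOf-map length arcsBlock Λ) (trans per-block
      (trans (sym (m+n∸n≡m _ (length Λ))) (cong (_∸ length Λ) (trans (sumOf-pred Λ nes) sizes)))))
    where
    u-blocks : Unique (concat Λ)
    u-blocks = Unique-resp-↭ (↭-sym pr) u
    per-block : sumOf (λ B → length (arcsBlock B)) Λ ≡ sumOf (λ B → length B ∸ 1) Λ
    per-block = sumOf-cong Λ (λ B B∈ → arcs-of-block B (Unique-block Λ u-blocks B∈) (All.lookup nes B∈))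
    sizes : sumOf length Λ ≡ length l
    sizes = trans (sym (length-concat Λ)) (↭-length pr)


-- Permuting the input list of `partitions` only permutes (up to reordering
-- of blocks and of elements within blocks) the list of outputs, so sums of
-- functions insensitive to such reorderings are unchanged.  This is needed
-- because [±(N+1)]₀ is not literally (N+1) ∷ −(N+1) ∷ [±N]₀.
module Reordering where

  open ListFacts
  open SetPartitions
  open import Data.Nat as ℕ using (ℕ; _+_)
  open import Data.List using (List; []; _∷_; [_]; concatMap)
  open import Data.List.Relation.Binary.Permutation.Propositional using (_↭_; ↭-refl)
  import Data.List.Relation.Binary.Permutation.Propositional as Perm
  open import Relation.Binary.PropositionalEquality hiding ([_])
  open import Data.Nat.Tactic.RingSolver
  open ≡-Reasoning

  infix 4 _≅_
  data _≅_ : Part → Part → Set where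
    ≅[] : [] ≅ []
    ≅prep : ∀ {B B' Λ Λ'} → B ↭ B' → Λ ≅ Λ' → (B ∷ Λ) ≅ (B' ∷ Λ')
    ≅swap : ∀ {B B' D D' Λ Λ'} → B ↭ B' → D ↭ D' → Λ ≅ Λ' → (B ∷ D ∷ Λ) ≅ (D' ∷ B' ∷ Λ')
    ≅trans : ∀ {Λ Λ' Λ''} → Λ ≅ Λ' → Λ' ≅ Λ'' → Λ ≅ Λ''

  ≅refl : ∀ Λ → Λ ≅ Λ
  ≅refl [] = ≅[]
  ≅refl (B ∷ Λ) = ≅prep ↭-refl (≅refl Λ)

  Invariant : (Part → ℕ) → Set
  Invariant g = ∀ {Λ Λ'} → Λ ≅ Λ' → g Λ ≡ g Λ'

  Invariant-∷ : ∀ {g} B → Invariant g → Invariant (λ M → g (B ∷ M))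
  Invariant-∷ B ig p = ig (≅prep ↭-refl p)

  insertEach-∷ : ∀ a B Λ (g : Part → ℕ) → sumOf g (insertEach a (B ∷ Λ)) ≡ g ((a ∷ B) ∷ Λ) + sumOf (λ M → g (B ∷ M)) (insertEach a Λ)
  insertEach-∷ a B Λ g = cong (g ((a ∷ B) ∷ Λ) +_) (sumOf-map g (B ∷_) (insertEach a Λ))

  private
    swap-left : ∀ a b c → a + (b + c) ≡ b + (a + c)
    swap-left = solve-∀

  insertEach-≅ : ∀ a {Λ Λ'} → Λ ≅ Λ' → ∀ g → Invariant g → sumOf g (insertEach a Λ) ≡ sumOf g (insertEach a Λ')
  insertEach-≅ a ≅[] g ig = refl
  insertEach-≅ a (≅prep {B} {B'} {Λ} {Λ'} b p) g ig = begin
    sumOf g (insertEach a (B ∷ Λ)) ≡⟨ insertEach-∷ a B Λ g ⟩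
    g ((a ∷ B) ∷ Λ) + sumOf (λ M → g (B ∷ M)) (insertEach a Λ)
      ≡⟨ cong₂ _+_ (ig (≅prep (Perm.prep a b) p))
           (trans (insertEach-≅ a p (λ M → g (B ∷ M)) (Invariant-∷ B ig)) (sumOf-cong′ (insertEach a Λ') (λ M → ig (≅prep b (≅refl M))))) ⟩
    g ((a ∷ B') ∷ Λ') + sumOf (λ M → g (B' ∷ M)) (insertEach a Λ')
      ≡⟨ sym (insertEach-∷ a B' Λ' g) ⟩
    sumOf g (insertEach a (B' ∷ Λ')) ∎
  insertEach-≅ a (≅swap {B} {B'} {D} {D'} {Λ} {Λ'} b c p) g ig = begin
    sumOf g (insertEach a (B ∷ D ∷ Λ)) ≡⟨ insertEach-∷ a B (D ∷ Λ) g ⟩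
    g ((a ∷ B) ∷ D ∷ Λ) + sumOf (λ M → g (B ∷ M)) (insertEach a (D ∷ Λ))
      ≡⟨ cong (g ((a ∷ B) ∷ D ∷ Λ) +_) (insertEach-∷ a D Λ (λ M → g (B ∷ M))) ⟩
    g ((a ∷ B) ∷ D ∷ Λ) + (g (B ∷ (a ∷ D) ∷ Λ) + sumOf (λ M → g (B ∷ D ∷ M)) (insertEach a Λ))
      ≡⟨ cong₂ (λ u v → u + (v + sumOf (λ M → g (B ∷ D ∷ M)) (insertEach a Λ))) (ig (≅swap (Perm.prep a b) c p)) (ig (≅swap b (Perm.prep a c) p)) ⟩
    g (D' ∷ (a ∷ B') ∷ Λ') + (g ((a ∷ D') ∷ B' ∷ Λ') + sumOf (λ M → g (B ∷ D ∷ M)) (insertEach a Λ))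
      ≡⟨ cong (λ z → g (D' ∷ (a ∷ B') ∷ Λ') + (g ((a ∷ D') ∷ B' ∷ Λ') + z))
           (trans (insertEach-≅ a p (λ M → g (B ∷ D ∷ M)) (λ q → ig (≅prep ↭-refl (≅prep ↭-refl q))))
                  (sumOf-cong′ (insertEach a Λ') (λ M → ig (≅swap b c (≅refl M))))) ⟩
    g (D' ∷ (a ∷ B') ∷ Λ') + (g ((a ∷ D') ∷ B' ∷ Λ') + sumOf (λ M → g (D' ∷ B' ∷ M)) (insertEach a Λ'))
      ≡⟨ swap-left (g (D' ∷ (a ∷ B') ∷ Λ')) (g ((a ∷ D') ∷ B' ∷ Λ')) (sumOf (λ M → g (D' ∷ B' ∷ M)) (insertEach a Λ')) ⟩
    g ((a ∷ D') ∷ B' ∷ Λ') + (g (D' ∷ (a ∷ B') ∷ Λ') + sumOf (λ M → g (D' ∷ B' ∷ M)) (insertEach a Λ'))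
      ≡⟨ sym (trans (insertEach-∷ a D' (B' ∷ Λ') g) (cong (g ((a ∷ D') ∷ B' ∷ Λ') +_) (insertEach-∷ a B' Λ' (λ M → g (D' ∷ M))))) ⟩
    sumOf g (insertEach a (D' ∷ B' ∷ Λ')) ∎
  insertEach-≅ a (≅trans p q) g ig = trans (insertEach-≅ a p g ig) (insertEach-≅ a q g ig)

  child-≅ : ∀ a g → Invariant g → Invariant (λ Λ → sumOf g (child a Λ))
  child-≅ a g ig p = cong₂ _+_ (ig (≅prep ↭-refl p)) (insertEach-≅ a p g ig)

  insertEach-commute : ∀ a b Λ g → Invariant g → sumOf (λ M → sumOf g (insertEach a M)) (insertEach b Λ) ≡ sumOf (λ M → sumOf g (insertEach b M)) (insertEach a Λ)
  insertEach-commute a b [] g ig = refl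
  insertEach-commute a b (B ∷ Λ) g ig = begin
    sumOf (λ M → sumOf g (insertEach a M)) (insertEach b (B ∷ Λ))
      ≡⟨ insertEach-∷ b B Λ (λ M → sumOf g (insertEach a M)) ⟩
    sumOf g (insertEach a ((b ∷ B) ∷ Λ)) + sumOf (λ M → sumOf g (insertEach a (B ∷ M))) (insertEach b Λ)
      ≡⟨ cong₂ _+_ (insertEach-∷ a (b ∷ B) Λ g)
          (trans (sumOf-cong′ (insertEach b Λ) (λ M → insertEach-∷ a B M g)) (sumOf-+ (λ M → g ((a ∷ B) ∷ M)) (λ M → sumOf (λ M' → g (B ∷ M')) (insertEach a M)) (insertEach b Λ))) ⟩
    (g ((a ∷ b ∷ B) ∷ Λ) + P) + (Q + R)
      ≡⟨ cong (λ z → (z + P) + (Q + R)) (ig (≅prep (Perm.swap a b ↭-refl) (≅refl Λ))) ⟩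
    (g ((b ∷ a ∷ B) ∷ Λ) + P) + (Q + R)
      ≡⟨ cong (λ z → (g ((b ∷ a ∷ B) ∷ Λ) + P) + (Q + z)) (insertEach-commute a b Λ (λ M → g (B ∷ M)) (Invariant-∷ B ig)) ⟩
    (g ((b ∷ a ∷ B) ∷ Λ) + P) + (Q + R')
      ≡⟨ interchange (g ((b ∷ a ∷ B) ∷ Λ)) P Q R' ⟩
    (g ((b ∷ a ∷ B) ∷ Λ) + Q) + (P + R')
      ≡⟨ sym (cong₂ _+_ (insertEach-∷ b (a ∷ B) Λ g)
          (trans (sumOf-cong′ (insertEach a Λ) (λ M → insertEach-∷ b B M g)) (sumOf-+ (λ M → g ((b ∷ B) ∷ M)) (λ M → sumOf (λ M' → g (B ∷ M')) (insertEach b M)) (insertEach a Λ)))) ⟩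
    sumOf g (insertEach b ((a ∷ B) ∷ Λ)) + sumOf (λ M → sumOf g (insertEach b (B ∷ M))) (insertEach a Λ)
      ≡⟨ sym (insertEach-∷ a B Λ (λ M → sumOf g (insertEach b M))) ⟩
    sumOf (λ M → sumOf g (insertEach b M)) (insertEach a (B ∷ Λ)) ∎
    where
    P = sumOf (λ M → g ((b ∷ B) ∷ M)) (insertEach a Λ)
    Q = sumOf (λ M → g ((a ∷ B) ∷ M)) (insertEach b Λ)
    R = sumOf (λ M → sumOf (λ M' → g (B ∷ M')) (insertEach a M)) (insertEach b Λ)
    R' = sumOf (λ M → sumOf (λ M' → g (B ∷ M')) (insertEach b M)) (insertEach a Λ)
    interchange : ∀ x p q r → (x + p) + (q + r) ≡ (x + q) + (p + r)
    interchange = solve-∀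

  child-commute : ∀ a b Λ g → Invariant g →
    sumOf (λ M → sumOf g (child a M)) (child b Λ) ≡ sumOf (λ M → sumOf g (child b M)) (child a Λ)
  child-commute a b Λ g ig = begin
    sumOf g (child a ([ b ] ∷ Λ)) + sumOf (λ M → sumOf g (child a M)) (insertEach b Λ)
      ≡⟨ cong₂ _+_ (cong (g ([ a ] ∷ [ b ] ∷ Λ) +_) (insertEach-∷ a [ b ] Λ g)) (sumOf-+ (λ M → g ([ a ] ∷ M)) (λ M → sumOf g (insertEach a M)) (insertEach b Λ)) ⟩
    (g ([ a ] ∷ [ b ] ∷ Λ) + (g ((a ∷ [ b ]) ∷ Λ) + Pa)) + (Qb + Ra)
      ≡⟨ cong₂ (λ u v → (u + (v + Pa)) + (Qb + Ra)) (ig (≅swap ↭-refl ↭-refl (≅refl Λ))) (ig (≅prep (Perm.swap a b ↭-refl) (≅refl Λ))) ⟩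
    (g ([ b ] ∷ [ a ] ∷ Λ) + (g ((b ∷ [ a ]) ∷ Λ) + Pa)) + (Qb + Ra)
      ≡⟨ cong (λ z → (g ([ b ] ∷ [ a ] ∷ Λ) + (g ((b ∷ [ a ]) ∷ Λ) + Pa)) + (Qb + z)) (insertEach-commute a b Λ g ig) ⟩
    (g ([ b ] ∷ [ a ] ∷ Λ) + (g ((b ∷ [ a ]) ∷ Λ) + Pa)) + (Qb + Rb)
      ≡⟨ interchange′ (g ([ b ] ∷ [ a ] ∷ Λ)) (g ((b ∷ [ a ]) ∷ Λ)) Pa Qb Rb ⟩
    (g ([ b ] ∷ [ a ] ∷ Λ) + (g ((b ∷ [ a ]) ∷ Λ) + Qb)) + (Pa + Rb)
      ≡⟨ sym (cong₂ _+_ (cong (g ([ b ] ∷ [ a ] ∷ Λ) +_) (insertEach-∷ b [ a ] Λ g)) (sumOf-+ (λ M → g ([ b ] ∷ M)) (λ M → sumOf g (insertEach b M)) (insertEach a Λ))) ⟩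
    sumOf g (child b ([ a ] ∷ Λ)) + sumOf (λ M → sumOf g (child b M)) (insertEach a Λ) ∎
    where
    Pa = sumOf (λ M → g ([ b ] ∷ M)) (insertEach a Λ)
    Qb = sumOf (λ M → g ([ a ] ∷ M)) (insertEach b Λ)
    Ra = sumOf (λ M → sumOf g (insertEach a M)) (insertEach b Λ)
    Rb = sumOf (λ M → sumOf g (insertEach b M)) (insertEach a Λ)
    interchange′ : ∀ x y p q r → (x + (y + p)) + (q + r) ≡ (x + (y + q)) + (p + r)
    interchange′ = solve-∀

  partitions-swap : ∀ a b zs g → Invariant g → sumOf g (partitions (a ∷ b ∷ zs)) ≡ sumOf g (partitions (b ∷ a ∷ zs))
  partitions-swap a b zs g ig = begin
    sumOf g (concatMap (child a) (concatMap (child b) P))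
      ≡⟨ sumOf-concatMap g (child a) (concatMap (child b) P) ⟩
    sumOf (λ M → sumOf g (child a M)) (concatMap (child b) P)
      ≡⟨ sumOf-concatMap _ (child b) P ⟩
    sumOf (λ Λ → sumOf (λ M → sumOf g (child a M)) (child b Λ)) P
      ≡⟨ sumOf-cong′ P (λ Λ → child-commute a b Λ g ig) ⟩
    sumOf (λ Λ → sumOf (λ M → sumOf g (child b M)) (child a Λ)) P
      ≡⟨ sym (sumOf-concatMap _ (child a) P) ⟩
    sumOf (λ M → sumOf g (child b M)) (concatMap (child a) P)
      ≡⟨ sym (sumOf-concatMap g (child b) (concatMap (child a) P)) ⟩
    sumOf g (concatMap (child b) (concatMap (child a) P)) ∎
    where
    P = partitions zs

  partitions-∷ : ∀ a xs ys → (∀ g → Invariant g → sumOf g (partitions xs) ≡ sumOf g (partitions ys)) →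
          ∀ g → Invariant g → sumOf g (partitions (a ∷ xs)) ≡ sumOf g (partitions (a ∷ ys))
  partitions-∷ a xs ys h g ig = trans (sumOf-concatMap g (child a) (partitions xs))
    (trans (h _ (child-≅ a g ig)) (sym (sumOf-concatMap g (child a) (partitions ys))))

  partitions-↭ : ∀ {xs ys} → xs ↭ ys → ∀ g → Invariant g → sumOf g (partitions xs) ≡ sumOf g (partitions ys)
  partitions-↭ Perm.refl g ig = refl
  partitions-↭ (Perm.prep {xs} {ys} x p) = partitions-∷ x xs ys (partitions-↭ p)
  partitions-↭ (Perm.swap {xs} {ys} x y p) g ig =
    trans (partitions-swap x y xs g ig) (partitions-∷ y (x ∷ xs) (x ∷ ys) (partitions-∷ x xs ys (partitions-↭ p)) g ig)
  partitions-↭ (Perm.trans p q) g ig = trans (partitions-↭ p g ig) (partitions-↭ q g ig)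


module TypeBInvariance where

  open ListFacts
  open SetPartitions
  open Reordering
  open import Data.Nat as ℕ using (ℕ; suc)
  open import Data.Integer as ℤ using (ℤ)
  open import Data.Bool using (Bool; _∧_; _∨_; not; if_then_else_)
  open import Data.Bool.Properties using (∨-assoc; ∨-comm; ∧-assoc; ∧-comm; ∨-isCommutativeMonoid; ∧-isCommutativeMonoid)
  open import Data.Bool.ListAction using (any; all; or; and)
  open import Data.List.Properties using (map-cong)
  open import Data.List using (List; [_]; length)
  open import Data.List.Relation.Binary.Permutation.Propositional using (_↭_; ↭-refl; ↭⇒↭ₛ)
  import Data.List.Relation.Binary.Permutation.Propositional.Properties as ↭
  import Data.List.Relation.Binary.Permutation.Setoid.Properties as ↭ₛ
  open import Relation.Binary.PropositionalEquality hiding ([_])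
  open import Function using (_∘_)

  private variable X : Set

  swap∨ : ∀ a b c → a ∨ (b ∨ c) ≡ b ∨ (a ∨ c)
  swap∨ a b c = trans (sym (∨-assoc a b c)) (trans (cong (_∨ c) (∨-comm a b)) (∨-assoc b a c))

  swap∧ : ∀ a b c → a ∧ (b ∧ c) ≡ b ∧ (a ∧ c)
  swap∧ a b c = trans (sym (∧-assoc a b c)) (trans (cong (_∧ c) (∧-comm a b)) (∧-assoc b a c))

  -- any and all are folds of commutative monoids, hence invariant under ↭
  any-↭ : ∀ (p : X → Bool) {xs ys} → xs ↭ ys → any p xs ≡ any p ys
  any-↭ p q = ↭ₛ.foldr-commMonoid (setoid Bool) ∨-isCommutativeMonoid (↭⇒↭ₛ (↭.map⁺ p q))

  all-↭ : ∀ (p : X → Bool) {xs ys} → xs ↭ ys → all p xs ≡ all p ys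
  all-↭ p q = ↭ₛ.foldr-commMonoid (setoid Bool) ∧-isCommutativeMonoid (↭⇒↭ₛ (↭.map⁺ p q))

  any-cong : ∀ {p q : X → Bool} xs → (∀ x → p x ≡ q x) → any p xs ≡ any q xs
  any-cong xs e = cong or (map-cong e xs)

  all-cong : ∀ {p q : X → Bool} xs → (∀ x → p x ≡ q x) → all p xs ≡ all q xs
  all-cong xs e = cong and (map-cong e xs)

  RespB : (List ℤ → Bool) → Set
  RespB p = ∀ {B B'} → B ↭ B' → p B ≡ p B'

  any-≅ : ∀ (p : List ℤ → Bool) → RespB p → ∀ {Λ Λ'} → Λ ≅ Λ' → any p Λ ≡ any p Λ'
  any-≅ p rp ≅[] = refl
  any-≅ p rp (≅prep b q) = cong₂ _∨_ (rp b) (any-≅ p rp q)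
  any-≅ p rp (≅swap {B} {B'} {D} {D'} {Λ} b c q) =
    trans (swap∨ (p B) (p D) (any p Λ)) (cong₂ (λ u v → u ∨ v) (rp c) (cong₂ _∨_ (rp b) (any-≅ p rp q)))
  any-≅ p rp (≅trans q r) = trans (any-≅ p rp q) (any-≅ p rp r)

  all-≅ : ∀ (p : List ℤ → Bool) → RespB p → ∀ {Λ Λ'} → Λ ≅ Λ' → all p Λ ≡ all p Λ'
  all-≅ p rp ≅[] = refl
  all-≅ p rp (≅prep b q) = cong₂ _∧_ (rp b) (all-≅ p rp q)
  all-≅ p rp (≅swap {B} {B'} {D} {D'} {Λ} b c q) =
    trans (swap∧ (p B) (p D) (all p Λ)) (cong₂ (λ u v → u ∧ v) (rp c) (cong₂ _∧_ (rp b) (all-≅ p rp q)))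
  all-≅ p rp (≅trans q r) = trans (all-≅ p rp q) (all-≅ p rp r)

  ∈ᵇ-↭ : ∀ i {B B'} → B ↭ B' → (i ∈ᵇ B) ≡ (i ∈ᵇ B')
  ∈ᵇ-↭ i q = any-↭ (i ==_) q

  ⊆ᵇ-↭ : ∀ {A A' B B'} → A ↭ A' → B ↭ B' → (A ⊆ᵇ B) ≡ (A' ⊆ᵇ B')
  ⊆ᵇ-↭ {A} {A'} {B} {B'} a b = trans (all-↭ (_∈ᵇ B) a) (all-cong A' (λ i → ∈ᵇ-↭ i b))

  ≈ᵇ-↭ : ∀ {A A' B B'} → A ↭ A' → B ↭ B' → (A ≈ᵇ B) ≡ (A' ≈ᵇ B')
  ≈ᵇ-↭ a b = cong₂ _∧_ (⊆ᵇ-↭ a b) (⊆ᵇ-↭ b a)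

  negBlock-↭ : ∀ {B B'} → B ↭ B' → negBlock B ↭ negBlock B'
  negBlock-↭ = ↭.map⁺ (λ z → ℤ.- z)

  negPart-≅ : ∀ {Λ Λ'} → Λ ≅ Λ' → negPart Λ ≅ negPart Λ'
  negPart-≅ ≅[] = ≅[]
  negPart-≅ (≅prep b q) = ≅prep (negBlock-↭ b) (negPart-≅ q)
  negPart-≅ (≅swap b c q) = ≅swap (negBlock-↭ b) (negBlock-↭ c) (negPart-≅ q)
  negPart-≅ (≅trans q r) = ≅trans (negPart-≅ q) (negPart-≅ r)

  ∈ᴮ-≅ : ∀ {B B' Λ Λ'} → B ↭ B' → Λ ≅ Λ' → (B ∈ᴮ Λ) ≡ (B' ∈ᴮ Λ')
  ∈ᴮ-≅ {B} {B'} {Λ} {Λ'} b q = trans (any-cong Λ (λ D → ≈ᵇ-↭ {B} {B'} {D} {D} b ↭-refl)) (any-≅ (B' ≈ᵇ_) (λ {D} {D'} c → ≈ᵇ-↭ {B'} {B'} {D} {D'} ↭-refl c) q)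

  ≈ᴾ-≅ : ∀ {Λ Λ' M M'} → Λ ≅ Λ' → M ≅ M' → (Λ ≈ᴾ M) ≡ (Λ' ≈ᴾ M')
  ≈ᴾ-≅ {Λ} {Λ'} {M} {M'} q r = cong₂ _∧_
    (trans (all-cong Λ (λ B → ∈ᴮ-≅ {B} {B} ↭-refl r)) (all-≅ (_∈ᴮ M') (λ {B} {B'} b → ∈ᴮ-≅ {B} {B'} b (≅refl M')) q))
    (trans (all-cong M (λ B → ∈ᴮ-≅ {B} {B} ↭-refl q)) (all-≅ (_∈ᴮ Λ') (λ {B} {B'} b → ∈ᴮ-≅ {B} {B'} b (≅refl Λ')) r))

  zeroBlockCondition : List ℤ → Bool
  zeroBlockCondition B = if B ≈ᵇ negBlock B then (ℤ.0ℤ ∈ᵇ B) else not (ℤ.0ℤ ∈ᵇ B)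

  zeroBlockCondition-↭ : RespB zeroBlockCondition
  zeroBlockCondition-↭ {B} {B'} b rewrite ≈ᵇ-↭ b (negBlock-↭ b) | ∈ᵇ-↭ ℤ.0ℤ b = refl

  isTypeB-≅ : ∀ {Λ Λ'} → Λ ≅ Λ' → isTypeB Λ ≡ isTypeB Λ'
  isTypeB-≅ q = cong₂ _∧_ (≈ᴾ-≅ (negPart-≅ q) q) (all-≅ zeroBlockCondition zeroBlockCondition-↭ q)

  length-≅ : ∀ {Λ Λ'} → Λ ≅ Λ' → length Λ ≡ length Λ'
  length-≅ ≅[] = refl
  length-≅ (≅prep b q) = cong suc (length-≅ q)
  length-≅ (≅swap b c q) = cong (suc ∘ suc) (length-≅ q)
  length-≅ (≅trans q r) = trans (length-≅ q) (length-≅ r)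

  typeBWeight : (ℕ → ℕ) → Part → ℕ
  typeBWeight f Λ = if isTypeB Λ then f (length Λ) else 0

  typeBWeight-invariant : ∀ f → Invariant (typeBWeight f)
  typeBWeight-invariant f q rewrite isTypeB-≅ q | length-≅ q = refl


module GroundSets where

  open import Data.Nat using (ℕ; suc; _<_)
  open import Data.Nat.Properties using (<-irrefl; suc-injective)
  open import Data.Integer as ℤ using (ℤ; +_; -[1+_])
  import Data.Integer.Properties as ℤ
  open import Data.List using (List; _∷_; [_]; _++_; map; upTo)
  open import Data.List.Properties using (upTo-∷ʳ; map-++; ++-assoc)
  open import Data.List.Membership.Propositional using (_∈_; _∉_)
  open import Data.List.Membership.Propositional.Properties using (∈-map⁻; ∈-map⁺; ∈-upTo⁻; ∈-++⁻; ∈-++⁺ˡ; ∈-++⁺ʳ)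
  open import Data.List.Relation.Unary.Any using (here; there)
  open import Data.List.Relation.Unary.All using (All; tabulate)
  open import Data.List.Relation.Unary.AllPairs using (_∷_)
  open import Data.Empty using (⊥)
  open import Data.List.Relation.Unary.Unique.Propositional using (Unique)
  import Data.List.Relation.Unary.Unique.Propositional.Properties as Unique
  open import Data.List.Relation.Binary.Permutation.Propositional using (_↭_; ↭-refl; ↭-trans; ↭-prep; ↭-swap; ↭-reflexive)
  open import Data.List.Relation.Binary.Permutation.Propositional.Properties using (shift; ++-comm)
  open import Data.Product using (∃; _×_; _,_)
  open import Data.Sum using (inj₁; inj₂)
  open import Relation.Binary.PropositionalEquality hiding ([_])

  neg : ℤ → ℤ
  neg z = ℤ.- z

  negatives : ℕ → List ℤ
  negatives N = map neg [ N ]ₙ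

  new⁺ : ℕ → ℤ
  new⁺ N = + suc N

  new⁻ : ℕ → ℤ
  new⁻ N = neg (new⁺ N)

  [suc]ₙ : ∀ N → [ suc N ]ₙ ≡ [ N ]ₙ ++ [ new⁺ N ]
  [suc]ₙ N = trans (cong (map (λ i → + suc i)) (sym (upTo-∷ʳ N))) (map-++ (λ i → + suc i) (upTo N) [ N ])

  ground-↭ : ∀ N → [± suc N ]₀ ↭ new⁺ N ∷ new⁻ N ∷ [± N ]₀
  ground-↭ N = ↭-trans (↭-reflexive (cong (ℤ.0ℤ ∷_) (cong₂ _++_ ([suc]ₙ N) negatives-suc)))
              (↭-trans (↭-prep ℤ.0ℤ regroup) (↭-trans (↭-swap ℤ.0ℤ p ↭-refl) (↭-prep p (↭-swap ℤ.0ℤ q ↭-refl))))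
    where
    p = new⁺ N
    q = new⁻ N
    P = [ N ]ₙ
    Q = negatives N
    negatives-suc : negatives (suc N) ≡ Q ++ [ q ]
    negatives-suc = trans (cong (map neg) ([suc]ₙ N)) (map-++ neg P [ p ])
    regroup : (P ++ [ p ]) ++ (Q ++ [ q ]) ↭ p ∷ q ∷ (P ++ Q)
    regroup = ↭-trans (↭-reflexive (++-assoc P [ p ] (Q ++ [ q ])))
              (↭-trans (shift p P (Q ++ [ q ]))
              (↭-prep p (↭-trans (↭-reflexive (sym (++-assoc P Q [ q ]))) (++-comm (P ++ Q) [ q ]))))

  ∈[]ₙ : ∀ {N z} → z ∈ [ N ]ₙ → ∃ λ i → i < N × z ≡ + suc i
  ∈[]ₙ z∈ with ∈-map⁻ (λ i → + suc i) z∈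
  ... | i , i∈ , refl = i , ∈-upTo⁻ i∈ , refl

  ∈negatives : ∀ {N z} → z ∈ negatives N → ∃ λ i → i < N × z ≡ -[1+ i ]
  ∈negatives z∈ with ∈-map⁻ neg z∈
  ... | y , y∈ , refl with ∈[]ₙ y∈
  ... | i , i<N , refl = i , i<N , refl

  neg-closed : ∀ N {z} → z ∈ [± N ]₀ → neg z ∈ [± N ]₀
  neg-closed N (here refl) = here refl
  neg-closed N (there z∈) with ∈-++⁻ [ N ]ₙ z∈
  ... | inj₁ z∈P = there (∈-++⁺ʳ [ N ]ₙ (∈-map⁺ neg z∈P))
  ... | inj₂ z∈Q with ∈-map⁻ neg z∈Q
  ... | y , y∈ , refl = there (∈-++⁺ˡ (subst (_∈ [ N ]ₙ) (sym (ℤ.neg-involutive y)) y∈))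

  unique-[]ₙ : ∀ N → Unique [ N ]ₙ
  unique-[]ₙ N = Unique.map⁺ (λ { refl → refl }) (Unique.upTo⁺ N)

  unique-[±]₀ : ∀ N → Unique [± N ]₀
  unique-[±]₀ N = all-nonzero ∷ Unique.++⁺ (unique-[]ₙ N) (Unique.map⁺ ℤ.neg-injective (unique-[]ₙ N)) disjoint
    where
    disjoint : ∀ {z} → z ∈ [ N ]ₙ × z ∈ negatives N → ⊥
    disjoint (z∈P , z∈Q) with ∈[]ₙ z∈P | ∈negatives z∈Q
    ... | _ , _ , refl | _ , _ , ()
    0∉ : ℤ.0ℤ ∉ [ N ]ₙ ++ negatives N
    0∉ z∈ with ∈-++⁻ [ N ]ₙ z∈
    ... | inj₁ z∈P with ∈[]ₙ z∈P
    ... | _ , _ , ()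
    0∉ z∈ | inj₂ z∈Q with ∈negatives z∈Q
    ... | _ , _ , ()
    all-nonzero : All (ℤ.0ℤ ≢_) ([ N ]ₙ ++ negatives N)
    all-nonzero = tabulate (λ z∈ 0≡z → 0∉ (subst (_∈ _) (sym 0≡z) z∈))

  new⁺∉ : ∀ N → new⁺ N ∉ [± N ]₀
  new⁺∉ N (here ())
  new⁺∉ N (there z∈) with ∈-++⁻ [ N ]ₙ z∈
  ... | inj₁ z∈P with ∈[]ₙ z∈P
  ... | i , i<N , e = <-irrefl (sym (suc-injective (ℤ.+-injective e))) i<N
  new⁺∉ N (there z∈) | inj₂ z∈Q with ∈negatives z∈Q
  ... | _ , _ , ()


-- The boolean test isTypeB, on a list of blocks X with duplicate-free union,
-- is equivalent to two properties of the relation "x and y lie in the same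
-- block of X": it is preserved by negation, and x ~ −x forces x ~ 0.
module TypeBCharacterisation where

  open ListFacts
  open SetPartitions
  open GroundSets using (neg)
  open TypeBInvariance using (zeroBlockCondition)
  open import Data.Integer as ℤ using (ℤ)
  open import Data.Integer.Properties using (neg-involutive)
  open import Data.Bool using (true; false)
  open import Data.Bool.ListAction using (all)
  open import Data.List using (List; concat)
  open import Data.List.Membership.Propositional using (_∈_; _∉_; find)
  open import Data.List.Membership.Propositional.Properties using (∈-map⁻; ∈-map⁺; ∈-concat⁺′; ∈-concat⁻′)
  import Data.List.Relation.Unary.Any as Any
  open import Data.List.Relation.Unary.All as All using (All)
  open import Data.List.Relation.Unary.Unique.Propositional using (Unique)
  open import Data.Product using (∃; _×_; _,_; proj₁; proj₂)
  open import Data.Empty using (⊥-elim)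
  open import Relation.Binary.PropositionalEquality hiding ([_])

  ∈ᵇ-true : ∀ {i B} → i ∈ B → (i ∈ᵇ B) ≡ true
  ∈ᵇ-true {i} {B} i∈ = any-intro (i ==_) B i∈ (⌊⌋-true (i ℤ.≟ i) refl)

  ∈ᵇ-sound : ∀ {i B} → (i ∈ᵇ B) ≡ true → i ∈ B
  ∈ᵇ-sound {i} {B} e = Any.map (⌊⌋-sound (i ℤ.≟ _)) (any-true (i ==_) B e)

  ∈ᵇ-false : ∀ {i B} → i ∉ B → (i ∈ᵇ B) ≡ false
  ∈ᵇ-false i∉ = not-true→false (λ e → i∉ (∈ᵇ-sound e))

  _⊆_ : List ℤ → List ℤ → Set
  A ⊆ B = ∀ z → z ∈ A → z ∈ B

  ⊆ᵇ-true : ∀ {A B} → A ⊆ B → (A ⊆ᵇ B) ≡ true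
  ⊆ᵇ-true {A} {B} A⊆B = all-intro (_∈ᵇ B) A (λ z z∈ → ∈ᵇ-true (A⊆B z z∈))

  ⊆ᵇ-sound : ∀ {A B} → (A ⊆ᵇ B) ≡ true → A ⊆ B
  ⊆ᵇ-sound {A} {B} e z z∈ = ∈ᵇ-sound (all-true (_∈ᵇ B) A e z z∈)

  ≈ᵇ-true : ∀ {A B} → A ⊆ B → B ⊆ A → (A ≈ᵇ B) ≡ true
  ≈ᵇ-true A⊆B B⊆A = ∧-intro (⊆ᵇ-true A⊆B) (⊆ᵇ-true B⊆A)

  ≈ᵇ-sound : ∀ {A B} → (A ≈ᵇ B) ≡ true → A ⊆ B × B ⊆ A
  ≈ᵇ-sound {A} {B} e = ⊆ᵇ-sound (proj₁ (∧-true e)) , ⊆ᵇ-sound {B} {A} (proj₂ (∧-true {A ⊆ᵇ B} e))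

  ∈ᴮ-true : ∀ {B C X} → C ∈ X → (B ≈ᵇ C) ≡ true → (B ∈ᴮ X) ≡ true
  ∈ᴮ-true {B} {C} {X} C∈ e = any-intro (B ≈ᵇ_) X C∈ e

  ∈ᴮ-sound : ∀ {B X} → (B ∈ᴮ X) ≡ true → ∃ λ C → C ∈ X × (B ≈ᵇ C) ≡ true
  ∈ᴮ-sound {B} {X} e = find (any-true (B ≈ᵇ_) X e)

  ∈negBlock⁻ : ∀ {z B} → z ∈ negBlock B → neg z ∈ B
  ∈negBlock⁻ {z} {B} z∈ with ∈-map⁻ neg z∈
  ... | y , y∈ , refl = subst (_∈ B) (sym (neg-involutive y)) y∈

  ∈negBlock⁺ : ∀ {z B} → neg z ∈ B → z ∈ negBlock B
  ∈negBlock⁺ {z} {B} z∈ = subst (_∈ negBlock B) (neg-involutive z) (∈-map⁺ neg z∈)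

  zeroBlockCondition-sound : ∀ {B} → zeroBlockCondition B ≡ true →
    ((B ≈ᵇ negBlock B) ≡ true → ℤ.0ℤ ∈ B) × (ℤ.0ℤ ∈ B → (B ≈ᵇ negBlock B) ≡ true)
  zeroBlockCondition-sound {B} e with B ≈ᵇ negBlock B | ℤ.0ℤ ∈ᵇ B in has0
  ... | true | true = (λ _ → ∈ᵇ-sound has0) , (λ _ → refl)
  ... | false | false = (λ ()) , (λ 0∈ → ⊥-elim (false≢true (trans (sym has0) (∈ᵇ-true 0∈))))

  zeroBlockCondition-true : ∀ {B} → ((B ≈ᵇ negBlock B) ≡ true → ℤ.0ℤ ∈ B) →
    (ℤ.0ℤ ∈ B → (B ≈ᵇ negBlock B) ≡ true) → zeroBlockCondition B ≡ true
  zeroBlockCondition-true {B} self⇒0 0⇒self with B ≈ᵇ negBlock B in self | ℤ.0ℤ ∈ᵇ B in has0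
  ... | true | true = refl
  ... | true | false = ⊥-elim (false≢true (trans (sym has0) (∈ᵇ-true (self⇒0 refl))))
  ... | false | true = ⊥-elim (false≢true (0⇒self (∈ᵇ-sound has0)))
  ... | false | false = refl

  SameBlock : Part → ℤ → ℤ → Set
  SameBlock X x y = ∃ λ B → B ∈ X × x ∈ B × y ∈ B

  NegationClosed : Part → Set
  NegationClosed X = ∀ x y → SameBlock X x y → SameBlock X (neg x) (neg y)

  ZeroCondition : Part → Set
  ZeroCondition X = ∀ x → SameBlock X x (neg x) → SameBlock X x ℤ.0ℤ

  same-block : ∀ X {B C x y} → Unique (concat X) → B ∈ X → x ∈ B → C ∈ X → x ∈ C → y ∈ C → y ∈ B
  same-block X {B} {C} {x} {y} u B∈ xB C∈ xC yC = subst (λ (D : List ℤ) → y ∈ D) (block-unique X {C} {B} {x} u C∈ B∈ xC xB) yC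

  module _ (X : Part) (u : Unique (concat X)) where

    negated-block : (negPart X ≈ᴾ X) ≡ true → ∀ {B} → B ∈ X → ∃ λ C → C ∈ X × negBlock B ⊆ C × C ⊆ negBlock B
    negated-block e {B} B∈ with ∈ᴮ-sound {negBlock B} {X} (all-true (_∈ᴮ X) (negPart X) (proj₁ (∧-true e)) (negBlock B) (∈-map⁺ negBlock B∈))
    ... | C , C∈ , eq = C , C∈ , ≈ᵇ-sound {negBlock B} {C} eq

    typeB-sound : isTypeB X ≡ true → NegationClosed X × ZeroCondition X
    typeB-sound e = negation-closed , zero-condition
      where
      symmetric = proj₁ (∧-true e)
      conditions = all-true zeroBlockCondition X (proj₂ (∧-true {negPart X ≈ᴾ X} e))
      negation-closed : NegationClosed X
      negation-closed x y (B , B∈ , xB , yB) with negated-block symmetric B∈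
      ... | C , C∈ , −B⊆C , _ = C , C∈ , −B⊆C (neg x) (∈negBlock⁺ (subst (_∈ B) (sym (neg-involutive x)) xB))
                                        , −B⊆C (neg y) (∈negBlock⁺ (subst (_∈ B) (sym (neg-involutive y)) yB))
      zero-condition : ZeroCondition X
      zero-condition x (B , B∈ , xB , −xB) with negated-block symmetric B∈
      ... | C , C∈ , −B⊆C , C⊆−B = B , B∈ , xB , proj₁ (zeroBlockCondition-sound (conditions B B∈)) (≈ᵇ-true B⊆−B −B⊆B)
        where
        C≡B : C ≡ B
        C≡B = block-unique X u C∈ B∈ (−B⊆C (neg x) (∈negBlock⁺ (subst (_∈ B) (sym (neg-involutive x)) xB))) −xB
        B⊆−B : B ⊆ negBlock B
        B⊆−B z z∈ = C⊆−B z (subst (z ∈_) (sym C≡B) z∈)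
        −B⊆B : negBlock B ⊆ B
        −B⊆B z z∈ = subst (z ∈_) C≡B (−B⊆C z z∈)

    module _ (nonEmpty : All NonEmpty X) (closed : ∀ z → z ∈ concat X → neg z ∈ concat X)
             (negation-closed : NegationClosed X) (zero-condition : ZeroCondition X) where

      negative-block : ∀ {B} → B ∈ X → ∃ λ C → C ∈ X × negBlock B ⊆ C × C ⊆ negBlock B
      negative-block {B} B∈ with All.lookup nonEmpty B∈
      ... | x , xB with ∈-concat⁻′ X (closed x (∈-concat⁺′ xB B∈))
      ... | C , −xC , C∈ = C , C∈ , −B⊆C , C⊆−B
        where
        −B⊆C : negBlock B ⊆ C
        −B⊆C z z∈ with negation-closed x (neg z) (B , B∈ , xB , ∈negBlock⁻ z∈)
        ... | C′ , C′∈ , a , b = same-block X {C} {C′} u C∈ −xC C′∈ a (subst (_∈ C′) (neg-involutive z) b)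
        C⊆−B : C ⊆ negBlock B
        C⊆−B z z∈ with negation-closed (neg x) z (C , C∈ , −xC , z∈)
        ... | B′ , B′∈ , a , b = ∈negBlock⁺ (same-block X u B∈ xB B′∈ (subst (_∈ B′) (neg-involutive x) a) b)

      zero-block-symmetric : ∀ {B} → B ∈ X → ℤ.0ℤ ∈ B → ∀ z → z ∈ B → neg z ∈ B
      zero-block-symmetric {B} B∈ 0B z zB with negation-closed z ℤ.0ℤ (B , B∈ , zB , 0B)
      ... | B′ , B′∈ , a , b = same-block X u B∈ 0B B′∈ b a

      typeB-complete : isTypeB X ≡ true
      typeB-complete = ∧-intro (∧-intro −X⊆X X⊆−X) (all-intro zeroBlockCondition X λ B B∈ → zeroBlockCondition-true (self⇒0 B∈) (0⇒self B∈))
        where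
        −X⊆X : all (_∈ᴮ X) (negPart X) ≡ true
        −X⊆X = all-intro (_∈ᴮ X) (negPart X) λ D D∈ → found D∈
          where
          found : ∀ {D} → D ∈ negPart X → (D ∈ᴮ X) ≡ true
          found D∈ with ∈-map⁻ negBlock D∈
          ... | B , B∈ , refl with negative-block B∈
          ... | C , C∈ , −B⊆C , C⊆−B = ∈ᴮ-true {negBlock B} {C} {X} C∈ (≈ᵇ-true −B⊆C C⊆−B)
        X⊆−X : all (_∈ᴮ negPart X) X ≡ true
        X⊆−X = all-intro (_∈ᴮ negPart X) X λ B B∈ → found B∈
          where
          found : ∀ {B} → B ∈ X → (B ∈ᴮ negPart X) ≡ true
          found {B} B∈ with negative-block B∈
          ... | C , C∈ , −B⊆C , C⊆−B = ∈ᴮ-true {B} {negBlock C} {negPart X} (∈-map⁺ negBlock C∈) (≈ᵇ-true B⊆−C −C⊆B)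
            where
            B⊆−C : B ⊆ negBlock C
            B⊆−C z z∈ = ∈negBlock⁺ (−B⊆C (neg z) (∈negBlock⁺ (subst (_∈ B) (sym (neg-involutive z)) z∈)))
            −C⊆B : negBlock C ⊆ B
            −C⊆B z z∈ = subst (_∈ B) (neg-involutive z) (∈negBlock⁻ (C⊆−B (neg z) (∈negBlock⁻ z∈)))
        self⇒0 : ∀ {B} → B ∈ X → (B ≈ᵇ negBlock B) ≡ true → ℤ.0ℤ ∈ B
        self⇒0 {B} B∈ eq with All.lookup nonEmpty B∈
        ... | x , xB with zero-condition x (B , B∈ , xB , ∈negBlock⁻ (proj₁ (≈ᵇ-sound {B} {negBlock B} eq) x xB))
        ... | B′ , B′∈ , a , b = same-block X u B∈ xB B′∈ a b
        0⇒self : ∀ {B} → B ∈ X → ℤ.0ℤ ∈ B → (B ≈ᵇ negBlock B) ≡ true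
        0⇒self {B} B∈ 0B = ≈ᵇ-true (λ z zB → ∈negBlock⁺ (zero-block-symmetric B∈ 0B z zB))
                                   (λ z z∈ → subst (_∈ B) (neg-involutive z) (zero-block-symmetric B∈ 0B (neg z) (∈negBlock⁻ z∈)))


module SameBlockUnderInsertion where

  open ListFacts
  open SetPartitions
  open TypeBCharacterisation
  open import Data.Nat using (_+_)
  open import Data.Integer using (ℤ)
  open import Data.Bool using (Bool; true; false; _∧_)
  open import Data.Bool.ListAction using (any)
  open import Data.List using (_∷_; concat)
  open import Data.List.Membership.Propositional using (_∈_; _∉_; find)
  open import Data.List.Membership.Propositional.Properties using (∈-++⁺ˡ; ∈-++⁺ʳ; ∈-++⁻; ∈-concat⁺′; ∈-concat⁻′)
  open import Data.List.Relation.Unary.Any using (here; there)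
  open import Data.List.Relation.Unary.Unique.Propositional using (Unique)
  open import Data.List.Relation.Binary.Permutation.Propositional.Properties using (∈-resp-↭)
  open import Data.Product using (_×_; _,_; proj₁; proj₂)
  open import Data.Sum using (inj₁; inj₂)
  open import Data.Empty using (⊥-elim)
  open import Relation.Nullary using (¬_)
  open import Relation.Binary.PropositionalEquality hiding ([_])

  sameBlock-down : ∀ {a M X x y} → Ins a M X → x ≢ a → y ≢ a → SameBlock X x y → SameBlock M x y
  sameBlock-down i x≢a y≢a (C , C∈ , xC , yC) with Ins-down i C∈
  ... | inj₁ C∈M = C , C∈M , xC , yC
  ... | inj₂ (B , B∈ , refl) = B , B∈ , drop-a xC x≢a , drop-a yC y≢a
    where
    drop-a : ∀ {z} → z ∈ _ ∷ B → z ≢ _ → z ∈ B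
    drop-a (here e) z≢a = ⊥-elim (z≢a e)
    drop-a (there z∈) _ = z∈

  sameBlock-up : ∀ {a M X x y} → Ins a M X → SameBlock M x y → SameBlock X x y
  sameBlock-up i (B , B∈ , xB , yB) with Ins-up i B∈
  ... | inj₁ B∈X = B , B∈X , xB , yB
  ... | inj₂ aB∈X = _ , aB∈X , there xB , there yB

  sameBlock-∷ : ∀ {B M x y} → SameBlock M x y → SameBlock (B ∷ M) x y
  sameBlock-∷ (C , C∈ , xC , yC) = C , there C∈ , xC , yC

  sameBlock-∷⁻ : ∀ {B M x y} → x ∉ B → SameBlock (B ∷ M) x y → SameBlock M x y
  sameBlock-∷⁻ x∉B (C , here refl , xC , _) = ⊥-elim (x∉B xC)
  sameBlock-∷⁻ x∉B (C , there C∈ , xC , yC) = C , C∈ , xC , yC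

  sameBlock-sym : ∀ {X x y} → SameBlock X x y → SameBlock X y x
  sameBlock-sym (C , C∈ , xC , yC) = C , C∈ , yC , xC

  sameBlock-trans : ∀ {X x y z} → Unique (concat X) → SameBlock X x y → SameBlock X y z → SameBlock X x z
  sameBlock-trans {X} u (B , B∈ , xB , yB) (C , C∈ , yC , zC) = B , B∈ , xB , same-block X u B∈ yB C∈ yC zC

  sameBlock-refl : ∀ {X x} → x ∈ concat X → SameBlock X x x
  sameBlock-refl {X} x∈ with ∈-concat⁻′ X x∈
  ... | B , xB , B∈ = B , B∈ , xB , xB

  sameBlock-∈ : ∀ {X x y} → SameBlock X x y → x ∈ concat X × y ∈ concat X
  sameBlock-∈ (B , B∈ , xB , yB) = ∈-concat⁺′ xB B∈ , ∈-concat⁺′ yB B∈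

  sameBlockᵇ : Part → ℤ → ℤ → Bool
  sameBlockᵇ X x y = any (λ C → (x ∈ᵇ C) ∧ (y ∈ᵇ C)) X

  sameBlockᵇ-true : ∀ {X x y} → SameBlock X x y → sameBlockᵇ X x y ≡ true
  sameBlockᵇ-true {X} {x} {y} (C , C∈ , xC , yC) = any-intro (λ C → (x ∈ᵇ C) ∧ (y ∈ᵇ C)) X C∈ (∧-intro (∈ᵇ-true xC) (∈ᵇ-true yC))

  sameBlockᵇ-sound : ∀ {X x y} → sameBlockᵇ X x y ≡ true → SameBlock X x y
  sameBlockᵇ-sound {X} {x} {y} e with find (any-true _ X e)
  ... | C , C∈ , both = C , C∈ , ∈ᵇ-sound (proj₁ (∧-true both)) , ∈ᵇ-sound (proj₂ (∧-true {x ∈ᵇ C} both))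

  sameBlockᵇ-false : ∀ {X x y} → ¬ SameBlock X x y → sameBlockᵇ X x y ≡ false
  sameBlockᵇ-false ¬same = not-true→false (λ e → ¬same (sameBlockᵇ-sound e))

  count-insertions : ∀ a z M → Unique (concat M) → z ∈ concat M → a ∉ concat M → z ≢ a →
    sumOf (λ X → ind (sameBlockᵇ X a z)) (insertEach a M) ≡ 1
  count-insertions a z (B ∷ M) u z∈ a∉ z≢a =
    trans (cong₂ _+_ first-insertion (sumOf-map (λ X → ind (sameBlockᵇ X a z)) (B ∷_) (insertEach a M))) rest
    where
    a∉B : a ∉ B
    a∉B a∈ = a∉ (∈-++⁺ˡ a∈)
    a∉M : a ∉ concat M
    a∉M a∈ = a∉ (∈-++⁺ʳ B a∈)
    first-insertion : ind (sameBlockᵇ ((a ∷ B) ∷ M) a z) ≡ ind (z ∈ᵇ B)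
    first-insertion = cong ind (bool-iff to from)
      where
      to : sameBlockᵇ ((a ∷ B) ∷ M) a z ≡ true → (z ∈ᵇ B) ≡ true
      to e with sameBlockᵇ-sound {(a ∷ B) ∷ M} e
      ... | C , here refl , _ , here z≡a = ⊥-elim (z≢a z≡a)
      ... | C , here refl , _ , there zB = ∈ᵇ-true zB
      ... | C , there C∈ , aC , _ = ⊥-elim (a∉M (∈-concat⁺′ aC C∈))
      from : (z ∈ᵇ B) ≡ true → sameBlockᵇ ((a ∷ B) ∷ M) a z ≡ true
      from e = sameBlockᵇ-true {(a ∷ B) ∷ M} (a ∷ B , here refl , here refl , there (∈ᵇ-sound e))
    -- the other insertions leave B untouched, and a ∉ B
    later-insertion : ∀ Y → sameBlockᵇ (B ∷ Y) a z ≡ sameBlockᵇ Y a z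
    later-insertion Y = bool-iff (λ e → sameBlockᵇ-true {Y} (sameBlock-∷⁻ {B} {Y} a∉B (sameBlockᵇ-sound {B ∷ Y} e)))
                                 (λ e → sameBlockᵇ-true {B ∷ Y} (sameBlock-∷ {B} {Y} (sameBlockᵇ-sound {Y} e)))
    rest : ind (z ∈ᵇ B) + sumOf (λ Y → ind (sameBlockᵇ (B ∷ Y) a z)) (insertEach a M) ≡ 1
    rest with ∈-++⁻ B z∈
    ... | inj₁ zB = cong₂ _+_ (cong ind (∈ᵇ-true zB))
           (trans (sumOf-cong (insertEach a M) (λ Y Y∈ → cong ind (trans (later-insertion Y) (sameBlockᵇ-false {Y} (apart Y Y∈)))))
                  (sumOf-0 (insertEach a M)))
      where
      apart : ∀ Y → Y ∈ insertEach a M → ¬ SameBlock Y a z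
      apart Y Y∈ same with ∈-resp-↭ (Ins-concat (∈→Ins a M Y∈)) (proj₂ (sameBlock-∈ same))
      ... | here z≡a = z≢a z≡a
      ... | there zM = Unique-disj B u zB zM
    ... | inj₂ zM = trans (cong₂ _+_ (cong ind (∈ᵇ-false {z} {B} (λ zB → Unique-disj B u zB zM)))
                                    (sumOf-cong (insertEach a M) (λ Y _ → cong ind (later-insertion Y))))
                          (count-insertions a z M (Unique-++ʳ B u) zM a∉M z≢a)


-- Let L be duplicate-free and closed under negation
-- and p ∉ L nonzero, q = −p.  The partitions of p ∷ q ∷ L arising from a
-- partition Λ₀ of L are: [p],[q] added as singletons (type B iff Λ₀ is);
-- {p,q} added as a block (never type B: it is self-negative without 0);
-- exactly one of p, q joining a block (never type B); and both joining
-- blocks, which is type B iff Λ₀ is and p went to the negative of q's block.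
-- So a type-B Λ₀ with b blocks accounts for weight f(b+2) + b·f(b)
-- (`pair-recursion`).
module PairRecursion where

  open ListFacts
  open SetPartitions
  open TypeBCharacterisation
  open SameBlockUnderInsertion
  open TypeBInvariance using (typeBWeight)
  open GroundSets using (neg)
  open import Data.Nat using (zero; suc; _+_; _*_)
  open import Data.Nat.Properties using (*-identityʳ; *-zeroʳ; +-identityʳ)
  open import Data.Integer as ℤ using (ℤ)
  open import Data.Integer.Properties using (neg-involutive)
  open import Data.Bool using (true; false; _∧_; if_then_else_)
  open import Data.List using (List; []; _∷_; [_]; concat; length)
  open import Data.List.Membership.Propositional using (_∈_; _∉_)
  open import Data.List.Relation.Unary.Unique.Propositional using (Unique)
  open import Data.List.Membership.Propositional.Properties using (∈-concat⁺′)
  open import Data.List.Relation.Unary.Any using (here; there)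
  open import Data.List.Relation.Unary.All as All using (All; []; _∷_)
  open import Data.List.Relation.Unary.AllPairs using (_∷_)
  open import Data.List.Relation.Binary.Permutation.Propositional using (_↭_; ↭-refl; ↭-sym; ↭-trans; ↭-prep; ↭-swap)
  open import Data.List.Relation.Binary.Permutation.Propositional.Properties using (∈-resp-↭)
  open import Data.Product using (∃; _×_; _,_; proj₁; proj₂)
  open import Data.Empty using (⊥-elim)
  open import Relation.Nullary using (¬_; yes; no)
  open import Relation.Binary.PropositionalEquality hiding ([_])

  -- In the application L = [±N]₀ and p = N+1.
  module _ (L : List ℤ) (uL : Unique L) (L-closed : ∀ z → z ∈ L → neg z ∈ L)
           (p : ℤ) (p∉L : p ∉ L) (p≢0 : p ≢ ℤ.0ℤ) where

    q : ℤ
    q = neg p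

    −q≡p : neg q ≡ p
    −q≡p = neg-involutive p

    q∉L : q ∉ L
    q∉L q∈ = p∉L (subst (_∈ L) −q≡p (L-closed q q∈))

    p≢q : p ≢ q
    p≢q p≡−p = p≢0 (self-negative p≡−p)
      where
      self-negative : ∀ {z} → z ≡ neg z → z ≡ ℤ.0ℤ
      self-negative {ℤ.+ zero} _ = refl
      self-negative {ℤ.+ suc n} ()
      self-negative {ℤ.-[1+ n ]} ()

    q≢0 : q ≢ ℤ.0ℤ
    q≢0 q≡0 = p≢0 (trans (sym −q≡p) (cong neg q≡0))

    L≢p : ∀ {z} → z ∈ L → z ≢ p
    L≢p z∈ refl = p∉L z∈

    L≢q : ∀ {z} → z ∈ L → z ≢ q
    L≢q z∈ refl = q∉L z∈

    q-fresh : All (q ≢_) L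
    q-fresh = All.tabulate (λ y∈ q≡y → q∉L (subst (_∈ L) (sym q≡y) y∈))

    L⁺ : List ℤ
    L⁺ = p ∷ q ∷ L

    unique-L⁺ : Unique L⁺
    unique-L⁺ = All.tabulate (λ { (here y≡q) p≡y → p≢q (trans p≡y y≡q) ; (there y∈) p≡y → p∉L (subst (_∈ L) (sym p≡y) y∈) })
              ∷ q-fresh ∷ uL

    closed-L⁺ : ∀ z → z ∈ L⁺ → neg z ∈ L⁺
    closed-L⁺ z (here refl) = there (here refl)
    closed-L⁺ z (there (here refl)) = here −q≡p
    closed-L⁺ z (there (there z∈)) = there (there (L-closed z z∈))

    module _ (X : Part) (covers : concat X ↭ L⁺) where
      unique-X : Unique (concat X)
      unique-X = Unique-resp-↭ (↭-sym covers) unique-L⁺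

      closed-X : ∀ z → z ∈ concat X → neg z ∈ concat X
      closed-X z z∈ = ∈-resp-↭ (↭-sym covers) (closed-L⁺ z (∈-resp-↭ covers z∈))

      in-L : ∀ {z} → z ∈ concat X → z ≢ p → z ≢ q → z ∈ L
      in-L z∈ z≢p z≢q with ∈-resp-↭ covers z∈
      ... | here z≡p = ⊥-elim (z≢p z≡p)
      ... | there (here z≡q) = ⊥-elim (z≢q z≡q)
      ... | there (there z∈L) = z∈L

    module _ (Λ₀ : Part) (Λ₀-partition : PartitionOf L Λ₀) where

      nonEmpty₀ : All NonEmpty Λ₀
      nonEmpty₀ = proj₁ Λ₀-partition

      covers₀ : concat Λ₀ ↭ L
      covers₀ = proj₂ Λ₀-partition

      unique₀ : Unique (concat Λ₀)
      unique₀ = Unique-resp-↭ (↭-sym covers₀) uL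

      ∈L : ∀ {z} → z ∈ concat Λ₀ → z ∈ L
      ∈L = ∈-resp-↭ covers₀

      closed₀ : ∀ z → z ∈ concat Λ₀ → neg z ∈ concat Λ₀
      closed₀ z z∈ = ∈-resp-↭ (↭-sym covers₀) (L-closed z (∈L z∈))

      witness : ∀ {B} → B ∈ Λ₀ → ∃ λ x → x ∈ B × x ∈ L
      witness B∈ with All.lookup nonEmpty₀ B∈
      ... | x , xB = x , xB , ∈L (∈-concat⁺′ xB B∈)

      typeB-restricts : ∀ X → concat X ↭ L⁺ →
        (∀ a b → a ∈ L → b ∈ L → SameBlock X a b → SameBlock Λ₀ a b) → (∀ a b → SameBlock Λ₀ a b → SameBlock X a b) →
        isTypeB X ≡ true → isTypeB Λ₀ ≡ true
      typeB-restricts X covers down up typeB-X = typeB-complete Λ₀ unique₀ nonEmpty₀ closed₀ negation-closed zero-condition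
        where
        X-sound = typeB-sound X (unique-X X covers) typeB-X
        negation-closed : NegationClosed Λ₀
        negation-closed a b ab with sameBlock-∈ ab
        ... | a∈ , b∈ = down (neg a) (neg b) (L-closed a (∈L a∈)) (L-closed b (∈L b∈)) (proj₁ X-sound a b (up a b ab))
        zero-condition : ZeroCondition Λ₀
        zero-condition a a−a with proj₂ X-sound a (up a (neg a) a−a)
        ... | a0 = down a ℤ.0ℤ (∈L (proj₁ (sameBlock-∈ a−a)))
                     (in-L X covers (proj₂ (sameBlock-∈ a0)) (λ e → p≢0 (sym e)) (λ e → q≢0 (sym e))) a0

      singleton : ∀ {a z : ℤ} → z ∈ [ a ] → z ≡ a
      singleton (here e) = e

      singletons-typeB : isTypeB ([ p ] ∷ [ q ] ∷ Λ₀) ≡ isTypeB Λ₀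
      singletons-typeB = bool-iff (typeB-restricts X covers down up) extend
        where
        X = [ p ] ∷ [ q ] ∷ Λ₀
        covers : concat X ↭ L⁺
        covers = ↭-prep p (↭-prep q covers₀)
        down : ∀ a b → a ∈ L → b ∈ L → SameBlock X a b → SameBlock Λ₀ a b
        down a b aL bL ab = sameBlock-∷⁻ {[ q ]} (λ a∈ → L≢q aL (singleton a∈)) (sameBlock-∷⁻ {[ p ]} (λ a∈ → L≢p aL (singleton a∈)) ab)
        up : ∀ a b → SameBlock Λ₀ a b → SameBlock X a b
        up a b ab = sameBlock-∷ (sameBlock-∷ ab)
        extend : isTypeB Λ₀ ≡ true → isTypeB X ≡ true
        extend typeB₀ = typeB-complete X (unique-X X covers) ((p , here refl) ∷ (q , here refl) ∷ nonEmpty₀) (closed-X X covers)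
                                       negation-closed zero-condition
          where
          Λ₀-sound = typeB-sound Λ₀ unique₀ typeB₀
          negation-closed : NegationClosed X
          negation-closed a b (C , here refl , aC , bC) =
            subst₂ (λ u v → SameBlock X (neg u) (neg v)) (sym (singleton aC)) (sym (singleton bC)) ([ q ] , there (here refl) , here refl , here refl)
          negation-closed a b (C , there (here refl) , aC , bC) =
            subst₂ (λ u v → SameBlock X (neg u) (neg v)) (sym (singleton aC)) (sym (singleton bC)) ([ p ] , here refl , here −q≡p , here −q≡p)
          negation-closed a b (C , there (there C∈) , aC , bC) = up (neg a) (neg b) (proj₁ Λ₀-sound a b (C , C∈ , aC , bC))
          zero-condition : ZeroCondition X
          zero-condition a (C , here refl , aC , −aC) = ⊥-elim (p≢q (trans (sym (singleton −aC)) (cong neg (singleton aC))))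
          zero-condition a (C , there (here refl) , aC , −aC) =
            ⊥-elim (p≢q (trans (sym −q≡p) (trans (cong neg (sym (singleton aC))) (singleton −aC))))
          zero-condition a (C , there (there C∈) , aC , −aC) = up a ℤ.0ℤ (proj₂ Λ₀-sound a (C , C∈ , aC , −aC))

      -- Case 2: the new block {p, q} is self-negative but misses 0.
      pair-block-not-typeB : isTypeB ((p ∷ [ q ]) ∷ Λ₀) ≡ false
      pair-block-not-typeB = not-true→false λ typeB →
        p≁0 (proj₂ (typeB-sound X (unique-X X covers) typeB) p ((p ∷ [ q ]) , here refl , here refl , there (here refl)))
        where
        X = (p ∷ [ q ]) ∷ Λ₀
        covers : concat X ↭ L⁺
        covers = ↭-prep p (↭-prep q covers₀)
        p≁0 : ¬ SameBlock X p ℤ.0ℤ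
        p≁0 (C , here refl , _ , here 0≡p) = p≢0 (sym 0≡p)
        p≁0 (C , here refl , _ , there (here 0≡q)) = q≢0 (sym 0≡q)
        p≁0 (C , there C∈ , pC , _) = p∉L (∈L (∈-concat⁺′ pC C∈))

      -- Case 3: p joins a block B ∋ y while q stays alone; then q ≁ −y.
      p-joined-not-typeB : ∀ X → X ∈ insertEach p Λ₀ → isTypeB ([ q ] ∷ X) ≡ false
      p-joined-not-typeB X X∈ = not-true→false λ typeB →
        q≁−y (proj₁ (typeB-sound X′ (unique-X X′ covers) typeB) p y (p ∷ B , there pB∈X , here refl , there yB))
        where
        ins = ∈→Ins p Λ₀ X∈
        X′ = [ q ] ∷ X
        covers : concat X′ ↭ L⁺
        covers = ↭-trans (↭-prep q (Ins-concat ins)) (↭-trans (↭-swap q p ↭-refl) (↭-prep p (↭-prep q covers₀)))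
        B = proj₁ (Ins-block ins)
        B∈ = proj₁ (proj₂ (Ins-block ins))
        pB∈X = proj₂ (proj₂ (Ins-block ins))
        y = proj₁ (witness B∈)
        yB = proj₁ (proj₂ (witness B∈))
        yL = proj₂ (proj₂ (witness B∈))
        q≁−y : ¬ SameBlock X′ q (neg y)
        q≁−y (C , here refl , _ , here −y≡q) = L≢p yL (trans (sym (neg-involutive y)) (trans (cong neg −y≡q) −q≡p))
        q≁−y (C , there C∈ , qC , _) with ∈-resp-↭ (Ins-concat ins) (∈-concat⁺′ qC C∈)
        ... | here q≡p = p≢q (sym q≡p)
        ... | there q∈ = q∉L (∈L q∈)

      module _ (M : Part) (M∈ : M ∈ insertEach q Λ₀) where

        insM = ∈→Ins q Λ₀ M∈
        B₀ = proj₁ (Ins-block insM)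
        B₀∈ = proj₁ (proj₂ (Ins-block insM))
        qB₀∈M = proj₂ (proj₂ (Ins-block insM))
        x = proj₁ (witness B₀∈)
        xB₀ = proj₁ (proj₂ (witness B₀∈))
        xL = proj₂ (proj₂ (witness B₀∈))

        q∼x : SameBlock M q x
        q∼x = q ∷ B₀ , qB₀∈M , here refl , there xB₀

        coversM : concat M ↭ q ∷ L
        coversM = ↭-trans (Ins-concat insM) (↭-prep q covers₀)

        -- Case 4: p stays alone; then p = −q ≁ −x.
        q-joined-not-typeB : isTypeB ([ p ] ∷ M) ≡ false
        q-joined-not-typeB = not-true→false λ typeB →
          −q≁−x (proj₁ (typeB-sound X (unique-X X covers) typeB) q x (sameBlock-∷ q∼x))
          where
          X = [ p ] ∷ M
          covers : concat X ↭ L⁺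
          covers = ↭-prep p coversM
          −q≁−x : ¬ SameBlock X (neg q) (neg x)
          −q≁−x (C , here refl , _ , here −x≡p) = L≢q xL (trans (sym (neg-involutive x)) (cong neg −x≡p))
          −q≁−x (C , there C∈ , −qC , _) with ∈-resp-↭ coversM (∈-concat⁺′ −qC C∈)
          ... | here −q≡q = p≢q (trans (sym −q≡p) −q≡q)
          ... | there −q∈ = p∉L (subst (_∈ L) −q≡p −q∈)

        module _ (X : Part) (X∈ : X ∈ insertEach p M) where

          insX = ∈→Ins p M X∈

          coversX : concat X ↭ L⁺
          coversX = ↭-trans (Ins-concat insX) (↭-prep p coversM)

          down : ∀ a b → a ∈ L → b ∈ L → SameBlock X a b → SameBlock Λ₀ a b
          down a b aL bL ab = sameBlock-down insM (L≢q aL) (L≢q bL) (sameBlock-down insX (L≢p aL) (L≢p bL) ab)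

          up : ∀ a b → SameBlock Λ₀ a b → SameBlock X a b
          up a b ab = sameBlock-up insX (sameBlock-up insM ab)

          q∼xX : SameBlock X q x
          q∼xX = sameBlock-up insX q∼x

          -- Folding p ↦ −x, q ↦ x moves every element to an element of L
          -- in the same block of X (when p ∼ −x), commuting with negation.
          module Folding (p∼−x : SameBlock X p (neg x)) where

            fold : ℤ → ℤ
            fold u with u ℤ.≟ p | u ℤ.≟ q
            ... | yes _ | _ = neg x
            ... | no _ | yes _ = x
            ... | no _ | no _ = u

            fold-p : fold p ≡ neg x
            fold-p with p ℤ.≟ p
            ... | yes _ = refl
            ... | no p≢p = ⊥-elim (p≢p refl)

            fold-q : fold q ≡ x
            fold-q with q ℤ.≟ p | q ℤ.≟ q
            ... | yes q≡p | _ = ⊥-elim (p≢q (sym q≡p))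
            ... | no _ | yes _ = refl
            ... | no _ | no q≢q = ⊥-elim (q≢q refl)

            fold-L : ∀ {u} → u ∈ L → fold u ≡ u
            fold-L {u} u∈ with u ℤ.≟ p | u ℤ.≟ q
            ... | yes u≡p | _ = ⊥-elim (L≢p u∈ u≡p)
            ... | no _ | yes u≡q = ⊥-elim (L≢q u∈ u≡q)
            ... | no _ | no _ = refl

            data Kind (u : ℤ) : Set where
              is-p : u ≡ p → Kind u
              is-q : u ≡ q → Kind u
              in-L′ : u ∈ L → Kind u

            kind : ∀ {u} → u ∈ concat X → Kind u
            kind u∈ with ∈-resp-↭ coversX u∈
            ... | here u≡p = is-p u≡p
            ... | there (here u≡q) = is-q u≡q
            ... | there (there u∈L) = in-L′ u∈L

            fold∈L : ∀ {u} → u ∈ concat X → fold u ∈ L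
            fold∈L u∈ with kind u∈
            ... | is-p refl = subst (_∈ L) (sym fold-p) (L-closed x xL)
            ... | is-q refl = subst (_∈ L) (sym fold-q) xL
            ... | in-L′ u∈L = subst (_∈ L) (sym (fold-L u∈L)) u∈L

            fold-same : ∀ {u} → u ∈ concat X → SameBlock X u (fold u)
            fold-same u∈ with kind u∈
            ... | is-p refl = subst (SameBlock X p) (sym fold-p) p∼−x
            ... | is-q refl = subst (SameBlock X q) (sym fold-q) q∼xX
            ... | in-L′ u∈L = subst (SameBlock X _) (sym (fold-L u∈L)) (sameBlock-refl u∈)

            fold-neg : ∀ {u} → u ∈ concat X → fold (neg u) ≡ neg (fold u)
            fold-neg u∈ with kind u∈
            ... | is-p refl = trans fold-q (trans (sym (neg-involutive x)) (cong neg (sym fold-p)))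
            ... | is-q refl = trans (cong fold −q≡p) (trans fold-p (cong neg (sym fold-q)))
            ... | in-L′ u∈L = trans (fold-L (L-closed _ u∈L)) (cong neg (sym (fold-L u∈L)))

            -- a ∼ b in X iff fold a ∼ fold b, and there Λ₀'s relation applies
            typeB-extends : isTypeB Λ₀ ≡ true → isTypeB X ≡ true
            typeB-extends typeB₀ = typeB-complete X u (Ins-nonEmpty insX (Ins-nonEmpty insM nonEmpty₀)) (closed-X X coversX)
                                                  negation-closed zero-condition
              where
              u = unique-X X coversX
              Λ₀-sound = typeB-sound Λ₀ unique₀ typeB₀
              via-fold : ∀ {a b} → SameBlock X a b → SameBlock X (fold a) (fold b)
              via-fold ab = sameBlock-trans u (sameBlock-sym (fold-same (proj₁ (sameBlock-∈ ab))))
                                              (sameBlock-trans u ab (fold-same (proj₂ (sameBlock-∈ ab))))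
              negation-closed : NegationClosed X
              negation-closed a b ab = sameBlock-trans u (fold-same −a∈) (sameBlock-trans u folded (sameBlock-sym (fold-same −b∈)))
                where
                a∈ = proj₁ (sameBlock-∈ ab)
                b∈ = proj₂ (sameBlock-∈ ab)
                −a∈ = closed-X X coversX a a∈
                −b∈ = closed-X X coversX b b∈
                in-Λ₀ : SameBlock Λ₀ (neg (fold a)) (neg (fold b))
                in-Λ₀ = proj₁ Λ₀-sound (fold a) (fold b) (down (fold a) (fold b) (fold∈L a∈) (fold∈L b∈) (via-fold ab))
                folded : SameBlock X (fold (neg a)) (fold (neg b))
                folded = subst₂ (SameBlock X) (sym (fold-neg a∈)) (sym (fold-neg b∈)) (up _ _ in-Λ₀)
              zero-condition : ZeroCondition X
              zero-condition a a−a = sameBlock-trans u (fold-same a∈)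
                (up (fold a) ℤ.0ℤ (proj₂ Λ₀-sound (fold a) (down (fold a) (neg (fold a)) (fold∈L a∈) (L-closed (fold a) (fold∈L a∈)) folded)))
                where
                a∈ = proj₁ (sameBlock-∈ a−a)
                folded : SameBlock X (fold a) (neg (fold a))
                folded = subst (SameBlock X (fold a)) (fold-neg a∈) (via-fold a−a)

          both-joined-typeB : isTypeB X ≡ (isTypeB Λ₀ ∧ sameBlockᵇ X p (neg x))
          both-joined-typeB = bool-iff restrict extend
            where
            restrict : isTypeB X ≡ true → (isTypeB Λ₀ ∧ sameBlockᵇ X p (neg x)) ≡ true
            restrict typeB = ∧-intro (typeB-restricts X coversX down up typeB)
              (sameBlockᵇ-true {X} (subst (λ z → SameBlock X z (neg x)) −q≡p (proj₁ (typeB-sound X (unique-X X coversX) typeB) q x q∼xX)))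
            extend : (isTypeB Λ₀ ∧ sameBlockᵇ X p (neg x)) ≡ true → isTypeB X ≡ true
            extend e = Folding.typeB-extends (sameBlockᵇ-sound {X} (proj₂ (∧-true {isTypeB Λ₀} e))) (proj₁ (∧-true e))

        -- Among the insertions of p into M, exactly the one into −x's block
        -- can be of type B, and it is iff Λ₀ is.
        sum-both-joined : ∀ f → sumOf (typeBWeight f) (insertEach p M) ≡ typeBWeight f Λ₀
        sum-both-joined f =
          trans (sumOf-cong (insertEach p M) weight)
          (trans (sumOf-* (typeBWeight f Λ₀) (λ X → ind (sameBlockᵇ X p (neg x))) (insertEach p M))
          (trans (cong (typeBWeight f Λ₀ *_) (count-insertions p (neg x) M uniqueM −x∈M p∉M (L≢p (L-closed x xL))))
                 (*-identityʳ _)))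
          where
          uniqueM : Unique (concat M)
          uniqueM = Unique-resp-↭ (↭-sym coversM) (q-fresh ∷ uL)
          −x∈M : neg x ∈ concat M
          −x∈M = ∈-resp-↭ (↭-sym coversM) (there (L-closed x xL))
          p∉M : p ∉ concat M
          p∉M p∈ with ∈-resp-↭ coversM p∈
          ... | here p≡q = p≢q p≡q
          ... | there p∈L = p∉L p∈L
          split-if : ∀ t r → (if t ∧ r then f (length Λ₀) else 0) ≡ (if t then f (length Λ₀) else 0) * ind r
          split-if true true = sym (*-identityʳ _)
          split-if true false = sym (*-zeroʳ (f (length Λ₀)))
          split-if false r = refl
          weight : ∀ X → X ∈ insertEach p M → typeBWeight f X ≡ typeBWeight f Λ₀ * ind (sameBlockᵇ X p (neg x))
          weight X X∈ = trans (cong₂ (λ t b → if t then f b else 0) (both-joined-typeB X X∈)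
                                     (trans (Ins-length (∈→Ins p M X∈)) (Ins-length insM)))
                              (split-if (isTypeB Λ₀) (sameBlockᵇ X p (neg x)))

      -- Summing over all ways to add the pair: singletons contribute
      -- f(b+2), the b blocks receiving q contribute f(b) each.
      pair-recursion : ∀ f → sumOf (λ M → sumOf (typeBWeight f) (child p M)) (child q Λ₀)
                             ≡ typeBWeight (λ b → f (suc (suc b)) + b * f b) Λ₀
      pair-recursion f = trans (cong₂ _+_ q-alone q-joined) combine
        where
        w₀ = typeBWeight f Λ₀
        w₂ = if isTypeB Λ₀ then f (suc (suc (length Λ₀))) else 0
        q-alone : sumOf (typeBWeight f) (child p ([ q ] ∷ Λ₀)) ≡ w₂
        q-alone = trans (cong₂ _+_ (cong (λ t → if t then f (suc (suc (length Λ₀))) else 0) singletons-typeB)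
                                   (cong₂ _+_ (cong (λ t → if t then f (suc (length Λ₀)) else 0) pair-block-not-typeB)
                                              (trans (sumOf-map (typeBWeight f) ([ q ] ∷_) (insertEach p Λ₀))
                                                     (trans (sumOf-cong (insertEach p Λ₀) (λ X X∈ → cong (λ t → if t then f (suc (length X)) else 0)
                                                                                                      (p-joined-not-typeB X X∈)))
                                                            (sumOf-0 (insertEach p Λ₀))))))
                        (+-identityʳ w₂)
        q-joined : sumOf (λ M → sumOf (typeBWeight f) (child p M)) (insertEach q Λ₀) ≡ length Λ₀ * w₀
        q-joined = trans (sumOf-cong (insertEach q Λ₀) (λ M M∈ → cong₂ _+_ (cong (λ t → if t then f (suc (length M)) else 0)
                                                                                 (q-joined-not-typeB M M∈))
                                                                           (sum-both-joined M M∈ f)))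
                         (trans (sumOf-const w₀ (insertEach q Λ₀)) (cong (_* w₀) (length-insertEach q Λ₀)))
        combine : w₂ + length Λ₀ * w₀ ≡ typeBWeight (λ b → f (suc (suc b)) + b * f b) Λ₀
        combine with isTypeB Λ₀
        ... | true = refl
        ... | false = *-zeroʳ (length Λ₀)


module Statistics where

  open ListFacts
  open RangeSums
  open TransferOperator
  open SetPartitions
  open ArcCount using (arc-count)
  open Reordering using (partitions-↭)
  open TypeBInvariance using (typeBWeight; typeBWeight-invariant)
  open GroundSets
  open import Data.Nat using (ℕ; zero; suc; _+_; _*_; _∸_; _^_; _≤_; _/_; _≟_)
  open import Data.Nat.Properties using (+-identityʳ; +-comm; *-comm; *-assoc; *-distribˡ-∸; *-cancelˡ-≡; +-cancelʳ-≡;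
                                         m+[n∸m]≡n; ^-distribˡ-+-*; m^n≢0)
  open import Data.Nat.DivMod using (m*n/n≡m)
  open import Data.Bool using (T?)
  open import Data.List using (List; [_]; concatMap; length)
  open import Data.List.Properties using (length-++; length-map)
  open import Data.List.Membership.Propositional using (_∈_)
  open import Data.List.Membership.Propositional.Properties using (∈-filter⁻)
  open import Data.Product using (_,_; proj₁)
  open import Relation.Binary.PropositionalEquality hiding ([_])
  open import Relation.Nullary using (Dec; yes; no)
  open import Data.Nat.Tactic.RingSolver
  open ≡-Reasoning

  -- Type A.  A partition of [N] with b blocks has N − b arcs.
  𝓑≡𝒯ⁿ : ∀ N x → 𝓑 N x ≡ 𝒯ⁿ joinA N (λ b → x ^ (N ∸ b)) 0
  𝓑≡𝒯ⁿ N x = begin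
    sumOf (λ Λ → x ^ length (Arc Λ)) (Π N)
      ≡⟨ sumOf-cong (Π N) (λ Λ Λ∈ → cong (x ^_) (trans (arc-count [ N ]ₙ Λ (unique-[]ₙ N) (partitions-sound [ N ]ₙ Λ∈))
                                                       (cong (_∸ length Λ) (length-[]ₙ N)))) ⟩
    sumOf (λ Λ → x ^ (N ∸ length Λ)) (Π N)
      ≡⟨ sum-over-blockCount [ N ]ₙ (λ b → x ^ (N ∸ b)) ⟩
    𝒯ⁿ joinA (length [ N ]ₙ) (λ b → x ^ (N ∸ b)) 0
      ≡⟨ cong (λ n → 𝒯ⁿ joinA n (λ b → x ^ (N ∸ b)) 0) (length-[]ₙ N) ⟩
    𝒯ⁿ joinA N (λ b → x ^ (N ∸ b)) 0 ∎

  S≡𝒯ⁿ : ∀ m j → S m j ≡ 𝒯ⁿ joinA m (δ j) 0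
  S≡𝒯ⁿ m j = begin
    S m j                                   ≡⟨ length-filterᵇ _ (Π m) ⟩
    sumOf (λ Λ → δ j (length Λ)) (Π m)      ≡⟨ sum-over-blockCount [ m ]ₙ (δ j) ⟩
    𝒯ⁿ joinA (length [ m ]ₙ) (δ j) 0        ≡⟨ cong (λ n → 𝒯ⁿ joinA n (δ j) 0) (length-[]ₙ m) ⟩
    𝒯ⁿ joinA m (δ j) 0                      ∎

  -- Type B.  The pair ±(N+1) may join the zero block or one of 2j blocks.
  joinB : ℕ → ℕ
  joinB j = 2 * j + 1

  twice : ℕ → ℕ
  twice l = 2 * l

  typeB-step : ∀ N f → sumOf (typeBWeight f) (partitions [± suc N ]₀)
                       ≡ sumOf (typeBWeight (λ b → f (suc (suc b)) + b * f b)) (partitions [± N ]₀)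
  typeB-step N f = begin
    sumOf (typeBWeight f) (partitions [± suc N ]₀)
      ≡⟨ partitions-↭ (ground-↭ N) (typeBWeight f) (typeBWeight-invariant f) ⟩
    sumOf (typeBWeight f) (concatMap (child p) (concatMap (child q) (partitions L)))
      ≡⟨ sumOf-concatMap (typeBWeight f) (child p) (concatMap (child q) (partitions L)) ⟩
    sumOf (λ M → sumOf (typeBWeight f) (child p M)) (concatMap (child q) (partitions L))
      ≡⟨ sumOf-concatMap (λ M → sumOf (typeBWeight f) (child p M)) (child q) (partitions L) ⟩
    sumOf (λ Λ₀ → sumOf (λ M → sumOf (typeBWeight f) (child p M)) (child q Λ₀)) (partitions L)
      ≡⟨ sumOf-cong (partitions L) (λ Λ₀ Λ₀∈ → PairRecursion.pair-recursion L (unique-[±]₀ N) (λ z z∈ → neg-closed N z∈)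
                                                 p (new⁺∉ N) (λ ()) Λ₀ (partitions-sound L Λ₀∈) f) ⟩
    sumOf (typeBWeight (λ b → f (suc (suc b)) + b * f b)) (partitions L) ∎
    where
    p = new⁺ N
    q = new⁻ N
    L = [± N ]₀

  -- type-B partitions have an odd number of blocks
  odd : ℕ → ℕ
  odd j = 2 * j + 1

  typeB-blockCount : ∀ N f → sumOf (λ Λ → f (length Λ)) (ΠB N) ≡ 𝒯ⁿ joinB N (λ j → f (odd j)) 0
  typeB-blockCount N f = trans (sumOf-filterᵇ (λ Λ → f (length Λ)) isTypeB (partitions [± N ]₀)) (iterate N f)
    where
    odd-step : ∀ j → suc (suc (2 * j + 1)) ≡ 2 * suc j + 1
    odd-step = solve-∀
    iterate : ∀ N f → sumOf (typeBWeight f) (partitions [± N ]₀) ≡ 𝒯ⁿ joinB N (λ j → f (odd j)) 0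
    iterate zero f = +-identityʳ (f 1)
    iterate (suc N) f = trans (typeB-step N f) (trans (iterate N (λ b → f (suc (suc b)) + b * f b))
                              (𝒯ⁿ-cong joinB N 0 (λ j → cong (_+ joinB j * f (odd j)) (cong f (odd-step j)))))

  length-[±]₀ : ∀ N → length [± N ]₀ ≡ suc (N + N)
  length-[±]₀ N = cong suc (trans (length-++ [ N ]ₙ) (cong₂ _+_ (length-[]ₙ N) (trans (length-map neg [ N ]ₙ) (length-[]ₙ N))))

  -- a type-B partition with 2j+1 blocks has 2(N − j) arcs
  half-arcs : ∀ N j → (suc (N + N) ∸ odd j) / 2 ≡ N ∸ j
  half-arcs N j = begin
    (suc (N + N) ∸ odd j) / 2   ≡⟨ cong (λ z → (suc (N + N) ∸ z) / 2) (+-comm (2 * j) 1) ⟩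
    (N + N ∸ 2 * j) / 2         ≡⟨ cong (λ z → (z ∸ 2 * j) / 2) (double N) ⟩
    (2 * N ∸ 2 * j) / 2         ≡⟨ cong (_/ 2) (sym (*-distribˡ-∸ 2 N j)) ⟩
    (2 * (N ∸ j)) / 2           ≡⟨ cong (_/ 2) (*-comm 2 (N ∸ j)) ⟩
    ((N ∸ j) * 2) / 2           ≡⟨ m*n/n≡m (N ∸ j) 2 ⟩
    N ∸ j                       ∎
    where
    double : ∀ N → N + N ≡ 2 * N
    double = solve-∀

  𝓑B≡𝒯ⁿ : ∀ N x → 𝓑B N x ≡ 𝒯ⁿ joinB N (λ j → x ^ (N ∸ j)) 0
  𝓑B≡𝒯ⁿ N x = begin
    sumOf (λ Λ → x ^ (length (Arc Λ) / 2)) (ΠB N)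
      ≡⟨ sumOf-cong (ΠB N) (λ Λ Λ∈ → cong (λ a → x ^ (a / 2))
           (trans (arc-count [± N ]₀ Λ (unique-[±]₀ N) (partitions-sound [± N ]₀ (∈-filterᵇ⁻ Λ∈)))
                  (cong (_∸ length Λ) (length-[±]₀ N)))) ⟩
    sumOf (λ Λ → x ^ ((suc (N + N) ∸ length Λ) / 2)) (ΠB N)
      ≡⟨ typeB-blockCount N (λ b → x ^ ((suc (N + N) ∸ b) / 2)) ⟩
    𝒯ⁿ joinB N (λ j → x ^ ((suc (N + N) ∸ odd j) / 2)) 0
      ≡⟨ 𝒯ⁿ-cong joinB N 0 (λ j → cong (x ^_) (half-arcs N j)) ⟩
    𝒯ⁿ joinB N (λ j → x ^ (N ∸ j)) 0 ∎
    where
    ∈-filterᵇ⁻ : ∀ {Λ} → Λ ∈ ΠB N → Λ ∈ partitions [± N ]₀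
    ∈-filterᵇ⁻ Λ∈ = proj₁ (∈-filter⁻ (λ Λ → T? (isTypeB Λ)) Λ∈)

  SB≡𝒯ⁿ : ∀ m j → SB m j ≡ 𝒯ⁿ joinB m (δ j) 0
  SB≡𝒯ⁿ m j = begin
    SB m j                                         ≡⟨ length-filterᵇ _ (ΠB m) ⟩
    sumOf (λ Λ → δ (2 * j + 1) (length Λ)) (ΠB m)  ≡⟨ typeB-blockCount m (δ (2 * j + 1)) ⟩
    𝒯ⁿ joinB m (λ i → δ (2 * j + 1) (odd i)) 0     ≡⟨ 𝒯ⁿ-cong joinB m 0 (δ-odd j) ⟩
    𝒯ⁿ joinB m (δ j) 0                             ∎
    where
    δ-odd : ∀ j i → δ (2 * j + 1) (2 * i + 1) ≡ δ j i
    δ-odd j i = by-cases (i ≟ j)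
      where
      odd-injective : ∀ {a b} → 2 * a + 1 ≡ 2 * b + 1 → a ≡ b
      odd-injective {a} {b} e = *-cancelˡ-≡ a b 2 (+-cancelʳ-≡ 1 (2 * a) (2 * b) e)
      by-cases : Dec (i ≡ j) → δ (2 * j + 1) (2 * i + 1) ≡ δ j i
      by-cases (yes refl) = trans (δ-same (2 * i + 1)) (sym (δ-same i))
      by-cases (no i≢j) = trans (δ-other (λ e → i≢j (odd-injective e))) (sym (δ-other i≢j))

  joinB-split : ∀ j l → joinB (j + l) ≡ (2 * j + 1) + twice l
  joinB-split = arith
    where
    arith : ∀ j l → 2 * (j + l) + 1 ≡ (2 * j + 1) + 2 * l
    arith = solve-∀

  𝒯ⁿ-twice : ∀ k x → 𝒯ⁿ twice k (λ l → x ^ (k ∸ l)) 0 ≡ 𝓑 k (2 * x)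
  𝒯ⁿ-twice k x = *-cancelˡ-≡ _ _ (2 ^ k) {{m^n≢0 2 k}} (begin
    2 ^ k * 𝒯ⁿ twice k (λ l → x ^ (k ∸ l)) 0       ≡⟨ sym (𝒯ⁿ-* twice k (2 ^ k) (λ l → x ^ (k ∸ l)) 0) ⟩
    𝒯ⁿ twice k (λ l → 2 ^ k * x ^ (k ∸ l)) 0       ≡⟨ 𝒯ⁿ-local twice k 0 (λ d d≤k → redistribute d d≤k) ⟩
    𝒯ⁿ (λ l → 2 * joinA l) k (λ l → 2 ^ l * (2 * x) ^ (k ∸ l)) 0
                                                   ≡⟨ 𝒯ⁿ-scale 2 joinA k (λ l → (2 * x) ^ (k ∸ l)) 0 ⟩
    2 ^ k * 𝒯ⁿ joinA k (λ l → (2 * x) ^ (k ∸ l)) 0 ≡⟨ cong (2 ^ k *_) (sym (𝓑≡𝒯ⁿ k (2 * x))) ⟩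
    2 ^ k * 𝓑 k (2 * x)                            ∎)
    where
    power-of-product : ∀ a → (2 * x) ^ a ≡ 2 ^ a * x ^ a
    power-of-product zero = refl
    power-of-product (suc a) = trans (cong (2 * x *_) (power-of-product a)) (reassoc (2 ^ a) x (x ^ a))
      where
      reassoc : ∀ p x r → 2 * x * (p * r) ≡ 2 * p * (x * r)
      reassoc = solve-∀
    redistribute : ∀ d → d ≤ k → 2 ^ k * x ^ (k ∸ d) ≡ 2 ^ d * (2 * x) ^ (k ∸ d)
    redistribute d d≤k = begin
      2 ^ k * x ^ (k ∸ d)                 ≡⟨ cong (λ e → 2 ^ e * x ^ (k ∸ d)) (sym (m+[n∸m]≡n d≤k)) ⟩
      2 ^ (d + (k ∸ d)) * x ^ (k ∸ d)     ≡⟨ cong (_* x ^ (k ∸ d)) (^-distribˡ-+-* 2 d (k ∸ d)) ⟩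
      2 ^ d * 2 ^ (k ∸ d) * x ^ (k ∸ d)   ≡⟨ *-assoc (2 ^ d) _ _ ⟩
      2 ^ d * (2 ^ (k ∸ d) * x ^ (k ∸ d)) ≡⟨ cong (2 ^ d *_) (sym (power-of-product (k ∸ d))) ⟩
      2 ^ d * (2 * x) ^ (k ∸ d)           ∎


proposition5p3 : ∀ (m n x : ℕ) →
  (𝓑 (m + n) x ≡ Σ[0‥ m ] (λ j → Σ[0‥ n ] (λ k →
      x ^ (m + n ∸ j ∸ k) * j ^ (n ∸ k) * (n C k) * S m j * 𝓑 k x)))
  × (𝓑B (m + n) x ≡ Σ[0‥ m ] (λ j → Σ[0‥ n ] (λ k →
      x ^ (m + n ∸ j ∸ k) * (2 * j + 1) ^ (n ∸ k) * (n C k) * SB m j * 𝓑 k (2 * x))))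
proposition5p3 m n x = typeA , typeB
  where
  open RangeSums
  open TransferOperator
  open SetPartitions using (joinA)
  open Statistics
  open import Relation.Binary.PropositionalEquality using (refl; cong₂; sym; module ≡-Reasoning)
  open ≡-Reasoning
  typeA : 𝓑 (m + n) x ≡ Σ[0‥ m ] (λ j → Σ[0‥ n ] (λ k →
            x ^ (m + n ∸ j ∸ k) * j ^ (n ∸ k) * (n C k) * S m j * 𝓑 k x))
  typeA = begin
    𝓑 (m + n) x                                    ≡⟨ 𝓑≡𝒯ⁿ (m + n) x ⟩
    𝒯ⁿ joinA (m + n) (λ b → x ^ (m + n ∸ b)) 0     ≡⟨ expansion joinA joinA (λ j → j) (λ j l → refl) m n x ⟩
    _                                              ≡⟨ double-sum m n _ _ (λ j k → cong₂ (λ s b → x ^ (m + n ∸ j ∸ k) * j ^ (n ∸ k) * (n C k) * s * b)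
                                                                            (sym (S≡𝒯ⁿ m j)) (sym (𝓑≡𝒯ⁿ k x))) ⟩
    _                                              ∎
  typeB : 𝓑B (m + n) x ≡ Σ[0‥ m ] (λ j → Σ[0‥ n ] (λ k →
            x ^ (m + n ∸ j ∸ k) * (2 * j + 1) ^ (n ∸ k) * (n C k) * SB m j * 𝓑 k (2 * x)))
  typeB = begin
    𝓑B (m + n) x                                   ≡⟨ 𝓑B≡𝒯ⁿ (m + n) x ⟩
    𝒯ⁿ joinB (m + n) (λ b → x ^ (m + n ∸ b)) 0     ≡⟨ expansion joinB twice (λ j → 2 * j + 1) joinB-split m n x ⟩
    _                                              ≡⟨ double-sum m n _ _ (λ j k → cong₂ (λ s b → x ^ (m + n ∸ j ∸ k) * (2 * j + 1) ^ (n ∸ k) * (n C k) * s * b)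
                                                                            (sym (SB≡𝒯ⁿ m j)) (𝒯ⁿ-twice k x)) ⟩
    _                                              ∎
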